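{- Let $k\geq 0$, $t\in\{0,1\}$, and let $\mathbf{C}=C_{3\cdot n_1,5\cdot n_2}$ be a snowflake with $M$ edges, $M\equiv t$ or $3-t\pmod 4$, whose center $z$ has degree $n=n_1+n_2\geq 1$; let $\{v_1,\ldots,v_n\}$ be the internal vertices of $\mathbf{C}$ other than $z$. Then there exist a labeling (bijection) $\phi:E(\mathbf{C})\to[1,n]\cup[n+1+k,M+k-1]\cup\{M+k+t\}$ and an orientation of $\mathbf{C}$ such that $s(v_i)=0$ for all $1\leq i\leq n$ and $s(z)\in\{1,2\}$.
   Context: $[a,b]=\{a,\ldots,b\}$. $C_{3\cdot n_1,5\cdot n_2}$ denotes the snowflake obtained from $n_1$ disjoint stars $K_{1,3}$ and $n_2$ disjoint stars $K_{1,5}$ by identifying one leaf of each star into a single vertex $z$ (the center); it has $M=3n_1+5n_2$ edges. An internal vertex is a vertex of degree at least $2$. Given an orientation and a labeling $\phi$ of the edges, the vertex-sum $s(u)$ is the sum of labels of arcs entering $u$ minus the sum of labels of arcs leaving $u$. -}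

module Defs where

open import Data.Nat using (ℕ; zero; suc; _+_; _*_; _∸_; _≤_; _<ᵇ_)
open import Data.Bool using (Bool; true; false; if_then_else_)
open import Data.Fin using (Fin; zero; suc; toℕ)
import Data.Fin.Properties as FinP
open import Data.Integer as ℤ using (ℤ; +_; -_)
open import Data.List using (List; []; _∷_; foldr; map; concatMap)
open import Data.List using () renaming (allFin to allFinL)
open import Data.Product using (Σ; _,_; _×_; proj₁; proj₂)
open import Data.Sum using (_⊎_)
open import Relation.Nullary using (yes; no)
open import Relation.Nullary.Decidable using (⌊_⌋)
open import Relation.Binary.PropositionalEquality using (_≡_; refl)

-- Stars are indexed by i : Fin (n₁ + n₂);
-- star i is a K_{1,3} if toℕ i < n₁, and a K_{1,5} otherwise.
-- degm1 i = (degree of the star centre v_i) - 1 = number of non-z leaves.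
degm1 : (n₁ n₂ : ℕ) → Fin (n₁ + n₂) → ℕ
degm1 n₁ n₂ i = if toℕ i <ᵇ n₁ then 2 else 4

deg : (n₁ n₂ : ℕ) → Fin (n₁ + n₂) → ℕ
deg n₁ n₂ i = suc (degm1 n₁ n₂ i)

-- Vertices: the centre z (hub), the star centres v_i (ctr i), and the
-- remaining leaves of star i (lf i j).
data Vertex (n₁ n₂ : ℕ) : Set where
  hub : Vertex n₁ n₂
  ctr : Fin (n₁ + n₂) → Vertex n₁ n₂
  lf  : (i : Fin (n₁ + n₂)) → Fin (degm1 n₁ n₂ i) → Vertex n₁ n₂

-- Edges: edge (i , j) joins ctr i with `other (i , j)`:
-- j = zero is the edge v_i z, j = suc j' is the edge v_i (lf i j').
Edge : (n₁ n₂ : ℕ) → Set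
Edge n₁ n₂ = Σ (Fin (n₁ + n₂)) (λ i → Fin (deg n₁ n₂ i))

other : {n₁ n₂ : ℕ} → Edge n₁ n₂ → Vertex n₁ n₂
other (i , zero)  = hub
other (i , suc j) = lf i j

edges : (n₁ n₂ : ℕ) → List (Edge n₁ n₂)
edges n₁ n₂ = concatMap (λ i → map (λ j → (i , j)) (allFinL (deg n₁ n₂ i))) (allFinL (n₁ + n₂))

-- An orientation: o e = true means e is directed from ctr i to other e,
-- o e = false means from other e to ctr i.
Orientation : (n₁ n₂ : ℕ) → Set
Orientation n₁ n₂ = Edge n₁ n₂ → Bool

tail head : {n₁ n₂ : ℕ} → Orientation n₁ n₂ → Edge n₁ n₂ → Vertex n₁ n₂
tail o (i , j) = if o (i , j) then ctr i else other (i , j)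
head o (i , j) = if o (i , j) then other (i , j) else ctr i

eqV : {n₁ n₂ : ℕ} → Vertex n₁ n₂ → Vertex n₁ n₂ → Bool
eqV hub hub = true
eqV (ctr i) (ctr i') = ⌊ i FinP.≟ i' ⌋
eqV (lf i j) (lf i' j') with i FinP.≟ i'
... | yes refl = ⌊ j FinP.≟ j' ⌋
... | no _ = false
eqV _ _ = false

sumℤ : List ℤ → ℤ
sumℤ = foldr ℤ._+_ (+ 0)

vsum : {n₁ n₂ : ℕ} → Orientation n₁ n₂ → (Edge n₁ n₂ → ℕ) → Vertex n₁ n₂ → ℤ
vsum {n₁} {n₂} o φ u = sumℤ (map contrib (edges n₁ n₂))
  where
  contrib : Edge n₁ n₂ → ℤ
  contrib e = (if eqV (head o e) u then + φ e else + 0)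
              ℤ.- (if eqV (tail o e) u then + φ e else + 0)

InLabels : (n k M t : ℕ) → ℕ → Set
InLabels n k M t m =
  (1 ≤ m × m ≤ n) ⊎ ((n + 1 + k ≤ m × m ≤ M + k ∸ 1) ⊎ m ≡ M + k + t)

-- Label the spoke z v_i with some c_i ∈ [1, n] and each leaf edge with A + p,
-- where A = n + 1 + k and the positions p run over [0, X) ∪ {X + t}, X = M - n - 1.
-- If half of the leaf edges at v_i enter it, A cancels in s(v_i), so s(v_i) = 0 asks that the
-- signed positions of the leaves of v_i sum to ± c_i; the sign is absorbed by the orientation
-- of the spoke. The positions come from a Skolem sequence of order n (hooked when n ≡ 2, 3
-- mod 4), whose pairs have differences 1, …, n: a K_{1,3} gets one pair and its difference as
-- label, and a K_{1,5} gets a pair of difference x ≤ n₂ plus an extra pair of small difference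
-- e, with label x + e, x - e or e - x, arranged so that these labels are again 1, …, n₂. The
-- congruence on M is exactly what lets the extra pairs fill the positions the Skolem sequence
-- leaves free. Finally the spokes are oriented so that ± 1 ± 2 ⋯ ± n ∈ {1, 2}.

module Submission where

open import Defs
open import Data.Nat as ℕ
  using (ℕ; zero; suc; _+_; _*_; _∸_; _≤_; _<_; _/_; _%_; _≟_; _≤?_; _≤ᵇ_; _<ᵇ_; _≡ᵇ_; pred; NonZero; s≤s; z≤n)
import Data.Nat.Properties as ℕ
open import Data.Nat.DivMod using (m≡m%n+[m/n]*n; m%n<n; [m+kn]%n≡m%n)
open import Data.Nat.Tactic.RingSolver using (solve-∀)
open import Data.Integer as ℤ using (ℤ; +_; -_)
import Data.Integer.Properties as ℤ
import Data.Integer.Tactic.RingSolver as ℤ-Solver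
open import Data.Bool using (Bool; true; false; T; not; _∨_; _xor_; if_then_else_)
open import Data.Bool.ListAction using (all)
open import Data.Unit using (⊤; tt)
open import Data.Empty using (⊥-elim)
open import Data.Fin using (Fin; zero; suc; toℕ; cast)
import Data.Fin.Properties as Fin
open import Data.List using (List; []; _∷_; _++_; _∷ʳ_; map; concat; concatMap; applyUpTo; tabulate; allFin; lookup; length)
import Data.List.Properties as List
open import Data.List.Membership.Propositional using (_∈_)
open import Data.List.Membership.Propositional.Properties using (∈-map⁺; ∈-map⁻; ∈-++⁺ˡ; ∈-++⁺ʳ; ∈-++⁻; ∈-concatMap⁺; ∈-allFin)
open import Data.List.Relation.Unary.Any using (here; there)
import Data.List.Relation.Unary.Any as Any
open import Data.List.Relation.Unary.All using (All; []; _∷_)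
import Data.List.Relation.Unary.All as All
open import Data.List.Relation.Unary.Unique.Propositional using (Unique; []; _∷_)
import Data.List.Relation.Unary.Unique.Propositional.Properties as Unique
open import Data.List.Relation.Binary.Permutation.Propositional
  using (_↭_; refl; prep; swap; trans; ↭-sym; ↭-reflexive; ↭⇒↭ₛ; module PermutationReasoning)
open import Data.List.Relation.Binary.Permutation.Propositional.Properties
  using (++⁺; ++⁺ˡ; ++⁺ʳ; ++-comm; shift; shifts; ∷↭∷ʳ; map⁺; ∈-resp-↭)
import Data.List.Relation.Binary.Permutation.Setoid.Properties as Perm
open import Data.List.Sort.InsertionSort.Base ℕ.≤-decTotalOrder using (sort)
open import Data.List.Sort.InsertionSort.Properties ℕ.≤-decTotalOrder using (sort-↭)
open import Data.Maybe using (Maybe; just; nothing)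
import Data.Maybe as Maybe
open import Data.Product using (Σ; ∃; _×_; _,_; proj₁; proj₂)
open import Data.Product.Properties using (≡-dec)
open import Data.Sum using (_⊎_; inj₁; inj₂; [_,_]′)
import Data.Sum
open import Function using (_∘_)
open import Function.Definitions using (Injective)
open import Relation.Nullary using (Dec; does; yes; no; ¬_)
open import Relation.Nullary.Decidable using (⌊_⌋; _×-dec_; dec-true; dec-false)
open import Relation.Binary.PropositionalEquality
  using (_≡_; _≢_; refl; cong; cong₂; sym; subst; module ≡-Reasoning) renaming (trans to ≡-trans; setoid to ≡-setoid)

progression : ℕ → ℕ → ℕ → List ℕ
progression d a zero    = []
progression d a (suc l) = a ∷ progression d (d + a) l

interval : ℕ → ℕ → List ℕ
interval = progression 1

progression-++ : ∀ d a l l′ → progression d a l ++ progression d (a + d * l) l′ ≡ progression d a (l + l′)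
progression-++ d a zero    l′ = cong (λ b → progression d b l′) (≡-trans (cong (λ b → a + b) (ℕ.*-zeroʳ d)) (ℕ.+-identityʳ a))
progression-++ d a (suc l) l′ =
  cong (a ∷_) (≡-trans (cong (λ b → progression d (d + a) l ++ progression d b l′) (shift-start d a l))
                       (progression-++ d (d + a) l l′))
  where
  shift-start : ∀ d a l → a + d * suc l ≡ d + a + d * l
  shift-start = solve-∀

interval-++ : ∀ a l l′ → interval a l ++ interval (a + l) l′ ≡ interval a (l + l′)
interval-++ a zero    l′ = cong (λ b → interval b l′) (ℕ.+-identityʳ a)
interval-++ a (suc l) l′ = cong (a ∷_) (≡-trans (cong (λ b → interval (suc a) l ++ interval b l′) (ℕ.+-suc a l))
                                                 (interval-++ (suc a) l l′))

interval-∷ʳ : ∀ a l → interval a l ∷ʳ (a + l) ≡ interval a (suc l)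
interval-∷ʳ a l = ≡-trans (interval-++ a l 1) (cong (interval a) (ℕ.+-comm l 1))

interval-↭-parities : ∀ a l → interval a (l + l) ↭ progression 2 a l ++ progression 2 (suc a) l
interval-↭-parities a zero    = refl
interval-↭-parities a (suc l) rewrite ℕ.+-suc l l =
  prep a (trans (prep (suc a) (interval-↭-parities (2 + a) l))
                (↭-sym (shift (suc a) (progression 2 (2 + a) l) (progression 2 (3 + a) l))))

interval-↭-parities′ : ∀ a l → interval a (suc (l + l)) ↭ progression 2 a (suc l) ++ progression 2 (suc a) l
interval-↭-parities′ a l =
  prep a (trans (interval-↭-parities (suc a) l) (++-comm (progression 2 (suc a) l) (progression 2 (2 + a) l)))

∈-interval⁻ : ∀ {a l x} → x ∈ interval a l → a ≤ x × x < a + l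
∈-interval⁻ {a} {suc l} (here refl) = ℕ.≤-refl , subst (suc a ≤_) (sym (ℕ.+-suc a l)) (s≤s (ℕ.m≤m+n a l))
∈-interval⁻ {a} {suc l} {x} (there x∈) with a<x , x<a+l ← ∈-interval⁻ {suc a} {l} x∈ =
  ℕ.≤-trans (ℕ.n≤1+n a) a<x , subst (x <_) (sym (ℕ.+-suc a l)) x<a+l

∈-interval⁺ : ∀ {a l x} → a ≤ x → x < a + l → x ∈ interval a l
∈-interval⁺ {a} {zero}  {x} a≤x x<a = ⊥-elim (ℕ.<⇒≱ x<a (subst (_≤ x) (sym (ℕ.+-identityʳ a)) a≤x))
∈-interval⁺ {a} {suc l} {x} a≤x x<a+l with ℕ.m≤n⇒m<n∨m≡n a≤x
... | inj₂ refl = here refl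
... | inj₁ a<x  = there (∈-interval⁺ a<x (subst (x <_) (ℕ.+-suc a l) x<a+l))

interval-unique : ∀ a l → Unique (interval a l)
interval-unique a zero    = []
interval-unique a (suc l) =
  All.tabulate (λ x∈ a≡x → ℕ.1+n≰n (subst (suc a ≤_) (sym a≡x) (proj₁ (∈-interval⁻ x∈)))) ∷ interval-unique (suc a) l

sumℤ-++ : ∀ xs ys → sumℤ (xs ++ ys) ≡ sumℤ xs ℤ.+ sumℤ ys
sumℤ-++ []       ys = sym (ℤ.+-identityˡ (sumℤ ys))
sumℤ-++ (x ∷ xs) ys = ≡-trans (cong (λ s → x ℤ.+ s) (sumℤ-++ xs ys)) (sym (ℤ.+-assoc x (sumℤ xs) (sumℤ ys)))

sumℤ-map-++ : {A : Set} (f : A → ℤ) (xs ys : List A) → sumℤ (map f (xs ++ ys)) ≡ sumℤ (map f xs) ℤ.+ sumℤ (map f ys)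
sumℤ-map-++ f xs ys = ≡-trans (cong sumℤ (List.map-++ f xs ys)) (sumℤ-++ (map f xs) (map f ys))

sumℤ-↭ : ∀ {xs ys} → xs ↭ ys → sumℤ xs ≡ sumℤ ys
sumℤ-↭ p = Perm.foldr-commMonoid (≡-setoid ℤ) ℤ.+-0-isCommutativeMonoid (↭⇒↭ₛ p)

interval-swap : ∀ n₁ n₂ → interval (suc n₂) n₁ ++ interval 1 n₂ ↭ interval 1 (n₁ + n₂)
interval-swap n₁ n₂ = trans (++-comm (interval (suc n₂) n₁) (interval 1 n₂))
                            (↭-reflexive (≡-trans (interval-++ 1 n₂ n₁) (cong (interval 1) (ℕ.+-comm n₂ n₁))))

length-interval : ∀ a l → length (interval a l) ≡ l
length-interval a zero    = refl
length-interval a (suc l) = cong suc (length-interval (suc a) l)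

sumℤ-concatMap : {A : Set} (f : A → List ℤ) (xs : List A) → sumℤ (concatMap f xs) ≡ sumℤ (map (sumℤ ∘ f) xs)
sumℤ-concatMap f []       = refl
sumℤ-concatMap f (x ∷ xs) = ≡-trans (sumℤ-++ (f x) (concatMap f xs)) (cong (λ s → sumℤ (f x) ℤ.+ s) (sumℤ-concatMap f xs))

sumℤ-neg : {A : Set} (f : A → ℤ) (xs : List A) → sumℤ (map (-_ ∘ f) xs) ≡ - sumℤ (map f xs)
sumℤ-neg f []       = refl
sumℤ-neg f (x ∷ xs) = ≡-trans (cong (λ s → - f x ℤ.+ s) (sumℤ-neg f xs)) (sym (ℤ.neg-distrib-+ (f x) _))

sumℤ-zero : {A : Set} (f : A → ℤ) (xs : List A) → (∀ x → f x ≡ + 0) → sumℤ (map f xs) ≡ + 0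
sumℤ-zero f []       _ = refl
sumℤ-zero f (x ∷ xs) z = cong₂ ℤ._+_ (z x) (sumℤ-zero f xs z)

map-allFin-suc : ∀ {A : Set} {n} (f : Fin (suc n) → A) → map f (tabulate suc) ≡ map (f ∘ suc) (allFin n)
map-allFin-suc f = ≡-trans (List.map-tabulate suc f) (sym (List.map-tabulate (λ j → j) (f ∘ suc)))

sumℤ-single : ∀ {n} (f : Fin n → ℤ) i → (∀ j → j ≢ i → f j ≡ + 0) → sumℤ (map f (allFin n)) ≡ f i
sumℤ-single {suc n} f zero    z =
  ≡-trans (cong (λ s → f zero ℤ.+ s) (≡-trans (cong sumℤ (map-allFin-suc f)) (sumℤ-zero (f ∘ suc) (allFin n) (λ j → z (suc j) λ ()))))
          (ℤ.+-identityʳ (f zero))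
sumℤ-single {suc n} f (suc i) z =
  ≡-trans (cong₂ ℤ._+_ (z zero λ ())
                       (≡-trans (cong sumℤ (map-allFin-suc f))
                                (sumℤ-single (f ∘ suc) i (λ j j≢i → z (suc j) (j≢i ∘ Fin.suc-injective)))))
          (ℤ.+-identityˡ (f (suc i)))

map-lookup-cast : {A B : Set} (F : A → B) (xs : List A) {m : ℕ} (eq : m ≡ length xs) →
  map (λ j → F (lookup xs (cast eq j))) (allFin m) ≡ map F xs
map-lookup-cast F xs refl = begin
  map (λ j → F (lookup xs (cast refl j))) (allFin (length xs)) ≡⟨ List.map-tabulate (λ j → j) _ ⟩
  tabulate (λ j → F (lookup xs (cast refl j)))                 ≡⟨ List.tabulate-cong (cong (F ∘ lookup xs) ∘ Fin.cast-is-id refl) ⟩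
  tabulate (F ∘ lookup xs)                                      ≡⟨ List.map-tabulate (lookup xs) F ⟨
  map F (tabulate (lookup xs))                                  ≡⟨ cong (map F) (List.tabulate-lookup xs) ⟩
  map F xs                                                      ∎
  where open ≡-Reasoning

concatMap-∷-↭ : {A B : Set} (f : A → B) (g : A → List B) (xs : List A) →
  concatMap (λ x → f x ∷ g x) xs ↭ map f xs ++ concatMap g xs
concatMap-∷-↭ f g []       = refl
concatMap-∷-↭ f g (x ∷ xs) = prep (f x) (trans (++⁺ˡ (g x) (concatMap-∷-↭ f g xs)) (shifts (g x) (map f xs)))

unique-map-injective : {A B : Set} (f : A → B) {xs : List A} → Unique (map f xs) →
  ∀ {x y} → x ∈ xs → y ∈ xs → f x ≡ f y → x ≡ y
unique-map-injective f             _              (here refl) (here refl) _   = refl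
unique-map-injective f {_ ∷ xs}    (fx∉ ∷ _)      (here refl) (there y∈) fx≡ = ⊥-elim (All.lookup fx∉ (∈-map⁺ f y∈) fx≡)
unique-map-injective f {_ ∷ xs}    (fy∉ ∷ _)      (there x∈) (here refl) fx≡ = ⊥-elim (All.lookup fy∉ (∈-map⁺ f x∈) (sym fx≡))
unique-map-injective f             (_ ∷ unique)   (there x∈) (there y∈) fx≡ = unique-map-injective f unique x∈ y∈ fx≡

concatMap-↭ : {A B : Set} (f : A → List B) {xs ys : List A} → xs ↭ ys → concatMap f xs ↭ concatMap f ys
concatMap-↭ f refl           = refl
concatMap-↭ f (prep x p)     = ++⁺ˡ (f x) (concatMap-↭ f p)
concatMap-↭ f (swap x y p)   = trans (shifts (f x) (f y)) (++⁺ˡ (f y) (++⁺ˡ (f x) (concatMap-↭ f p)))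
concatMap-↭ f (trans p q)    = trans (concatMap-↭ f p) (concatMap-↭ f q)

concatMap-++-↭ : {A B : Set} (f g : A → List B) (xs : List A) →
  concatMap (λ x → f x ++ g x) xs ↭ concatMap f xs ++ concatMap g xs
concatMap-++-↭ f g []       = refl
concatMap-++-↭ f g (x ∷ xs) =
  trans (↭-reflexive (List.++-assoc (f x) (g x) _))
        (trans (++⁺ˡ (f x) (trans (++⁺ˡ (g x) (concatMap-++-↭ f g xs)) (shifts (g x) (concatMap f xs))))
               (↭-reflexive (sym (List.++-assoc (f x) (concatMap f xs) _))))

nth : {A : Set} → A → List A → ℕ → A
nth d []       c       = d
nth d (y ∷ ys) zero    = y
nth d (y ∷ ys) (suc c) = nth d ys c

All-nth : {A : Set} {P : A → Set} {d : A} {xs : List A} → All P xs → P d → ∀ c → P (nth d xs c)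
All-nth []         pd c       = pd
All-nth (py ∷ _)   pd zero    = py
All-nth (_ ∷ pys)  pd (suc c) = All-nth pys pd c

applyUpTo-nth : {A B : Set} (G : A → B) (d : A) (xs : List A) {m : ℕ} → length xs ≡ m → applyUpTo (G ∘ nth d xs) m ≡ map G xs
applyUpTo-nth G d []       refl = refl
applyUpTo-nth G d (y ∷ ys) refl = cong (G y ∷_) (applyUpTo-nth G d ys refl)

map-toℕ-allFin : {A : Set} (f : ℕ → A) (m : ℕ) → map (f ∘ toℕ) (allFin m) ≡ applyUpTo f m
map-toℕ-allFin f m = ≡-trans (List.map-tabulate (λ i → i) (f ∘ toℕ)) (tabulate-toℕ f m)
  where
  tabulate-toℕ : ∀ {A : Set} (f : ℕ → A) m → tabulate {n = m} (f ∘ toℕ) ≡ applyUpTo f m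
  tabulate-toℕ f zero    = refl
  tabulate-toℕ f (suc m) = cong (f 0 ∷_) (tabulate-toℕ (f ∘ suc) m)

applyUpTo-if : {A B : Set} (F : A → B) (m k : ℕ) (f g : ℕ → A) →
  applyUpTo (λ c → F (if c <ᵇ m then f c else g (c ∸ m))) (m + k) ≡ applyUpTo (F ∘ f) m ++ applyUpTo (F ∘ g) k
applyUpTo-if F zero    k f g = refl
applyUpTo-if F (suc m) k f g = cong (F (f 0) ∷_) (applyUpTo-if F m k (f ∘ suc) g)

-- Tiling lists of affine progressions

Affine : Set
Affine = ℕ × ℕ × ℕ

⟦_⟧ : Affine → ℕ → ℕ → ℕ
⟦ c , a , b ⟧ x y = c + a * x + b * y

infixl 6 _⊕_ _⊝_
infixl 7 _⊛_ _⊘_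
infix 4 _≤ₐ_ _≟ₐ_ _≤ₐ?_

_⊕_ _⊝_ : Affine → Affine → Affine
(c , a , b) ⊕ (c′ , a′ , b′) = (c + c′ , a + a′ , b + b′)
(c , a , b) ⊝ (c′ , a′ , b′) = (c ∸ c′ , a ∸ a′ , b ∸ b′)

_⊛_ : ℕ → Affine → Affine
k ⊛ (c , a , b) = (k * c , k * a , k * b)

_⊘_ : Affine → (d : ℕ) .{{_ : NonZero d}} → Affine
(c , a , b) ⊘ d = (c / d , a / d , b / d)

_≤ₐ_ : Affine → Affine → Set
(c , a , b) ≤ₐ (c′ , a′ , b′) = c ≤ c′ × a ≤ a′ × b ≤ b′

_≟ₐ_ : (u v : Affine) → Dec (u ≡ v)
_≟ₐ_ = ≡-dec _≟_ (≡-dec _≟_ _≟_)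

_≤ₐ?_ : (u v : Affine) → Dec (u ≤ₐ v)
(c , a , b) ≤ₐ? (c′ , a′ , b′) = c ≤? c′ ×-dec (a ≤? a′ ×-dec b ≤? b′)

⟦⊕⟧ : ∀ u v x y → ⟦ u ⊕ v ⟧ x y ≡ ⟦ u ⟧ x y + ⟦ v ⟧ x y
⟦⊕⟧ (c , a , b) (c′ , a′ , b′) x y = lemma c a b c′ a′ b′ x y
  where
  lemma : ∀ c a b c′ a′ b′ x y → c + c′ + (a + a′) * x + (b + b′) * y ≡ c + a * x + b * y + (c′ + a′ * x + b′ * y)
  lemma = solve-∀

⟦⊛⟧ : ∀ k u x y → ⟦ k ⊛ u ⟧ x y ≡ k * ⟦ u ⟧ x y
⟦⊛⟧ k (c , a , b) x y = lemma k c a b x y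
  where
  lemma : ∀ k c a b x y → k * c + k * a * x + k * b * y ≡ k * (c + a * x + b * y)
  lemma = solve-∀

⊕-⊝ : ∀ {u v} → u ≤ₐ v → u ⊕ (v ⊝ u) ≡ v
⊕-⊝ (c≤ , a≤ , b≤) = cong₂ _,_ (ℕ.m+[n∸m]≡n c≤) (cong₂ _,_ (ℕ.m+[n∸m]≡n a≤) (ℕ.m+[n∸m]≡n b≤))

-- Identities xs ↭ ys between lists of progressions whose starts and lengths are affine in two
-- parameters x and y are decided by computation: a block (s , l) of step d stands for the
-- progression of length l from s, and the blocks of xs are cut one by one out of the segments of ys.
Block : Set
Block = Affine × Affine

block : ℕ → ℕ → ℕ → Block → List ℕ
block d x y (s , l) = progression d (⟦ s ⟧ x y) (⟦ l ⟧ x y)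

carveAt : ℕ → Affine → Block → Block → Maybe (List Block)
carveAt d k (s , l) (s′ , L) with s′ ⊕ d ⊛ k ≟ₐ s | k ⊕ l ≤ₐ? L
... | yes _ | yes _ = just ((s′ , k) ∷ (s ⊕ d ⊛ l , L ⊝ (k ⊕ l)) ∷ [])
... | _     | _     = nothing

carve : (d : ℕ) .{{_ : NonZero d}} → Block → Block → Maybe (List Block)
carve d b@(s , _) g@(s′ , _) = carveAt d ((s ⊝ s′) ⊘ d) b g

block-split : ∀ d x y s k l r →
  block d x y (s , k ⊕ l ⊕ r) ≡ block d x y (s , k) ++ block d x y (s ⊕ d ⊛ k , l) ++ block d x y (s ⊕ d ⊛ k ⊕ d ⊛ l , r)
block-split d x y s k l r = begin
  progression d S (⟦ k ⊕ l ⊕ r ⟧ x y)             ≡⟨ cong (progression d S) (≡-trans (⟦⊕⟧ (k ⊕ l) r x y) (cong (_+ R) (⟦⊕⟧ k l x y))) ⟩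
  progression d S (K + L + R)                      ≡⟨ cong (progression d S) (ℕ.+-assoc K L R) ⟩
  progression d S (K + (L + R))                    ≡⟨ progression-++ d S K (L + R) ⟨
  progression d S K ++ progression d (S + d * K) (L + R)
    ≡⟨ cong (progression d S K ++_) (progression-++ d (S + d * K) L R) ⟨
  progression d S K ++ progression d (S + d * K) L ++ progression d (S + d * K + d * L) R
    ≡⟨ cong₂ (λ a b → progression d S K ++ progression d a L ++ progression d b R) (sym start₁) (sym start₂) ⟩
  block d x y (s , k) ++ block d x y (s ⊕ d ⊛ k , l) ++ block d x y (s ⊕ d ⊛ k ⊕ d ⊛ l , r) ∎
  where
  open ≡-Reasoning
  S K L R : ℕ
  S = ⟦ s ⟧ x y
  K = ⟦ k ⟧ x y
  L = ⟦ l ⟧ x y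
  R = ⟦ r ⟧ x y
  start₁ : ⟦ s ⊕ d ⊛ k ⟧ x y ≡ S + d * K
  start₁ = ≡-trans (⟦⊕⟧ s (d ⊛ k) x y) (cong (λ b → S + b) (⟦⊛⟧ d k x y))
  start₂ : ⟦ s ⊕ d ⊛ k ⊕ d ⊛ l ⟧ x y ≡ S + d * K + d * L
  start₂ = ≡-trans (⟦⊕⟧ (s ⊕ d ⊛ k) (d ⊛ l) x y) (cong₂ _+_ start₁ (⟦⊛⟧ d l x y))

carveAt-↭ : ∀ d k b g {gs} x y → carveAt d k b g ≡ just gs →
  block d x y g ↭ block d x y b ++ concatMap (block d x y) gs
carveAt-↭ d k (s , l) (s′ , L) x y eq with s′ ⊕ d ⊛ k ≟ₐ s | k ⊕ l ≤ₐ? L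
carveAt-↭ d k (._ , l) (s′ , L) x y refl | yes refl | yes k+l≤L =
  trans (↭-reflexive (≡-trans (cong (λ L′ → block d x y (s′ , L′)) (sym (⊕-⊝ k+l≤L)))
                              (block-split d x y s′ k l (L ⊝ (k ⊕ l)))))
        (trans (shifts (block d x y (s′ , k)) (block d x y (s′ ⊕ d ⊛ k , l)))
               (++⁺ˡ (block d x y (s′ ⊕ d ⊛ k , l)) (++⁺ˡ (block d x y (s′ , k)) (↭-reflexive (sym (List.++-identityʳ _))))))
carveAt-↭ d k (s , l) (s′ , L) x y () | yes _ | no _
carveAt-↭ d k (s , l) (s′ , L) x y () | no _  | _

replaceFirst : {A : Set} → (A → Maybe (List A)) → List A → Maybe (List A)
replaceFirst f []       = nothing
replaceFirst f (x ∷ xs) with f x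
... | just ys = just (ys ++ xs)
... | nothing = Maybe.map (x ∷_) (replaceFirst f xs)

replaceFirst-↭ : {A B : Set} (g : A → List B) (f : A → Maybe (List A)) (bs : List B) →
  (∀ x {ys} → f x ≡ just ys → g x ↭ bs ++ concatMap g ys) →
  ∀ xs {zs} → replaceFirst f xs ≡ just zs → concatMap g xs ↭ bs ++ concatMap g zs
replaceFirst-↭ g f bs split (x ∷ xs) eq with f x in fx
replaceFirst-↭ g f bs split (x ∷ xs) refl | just ys =
  trans (++⁺ʳ (concatMap g xs) (split x fx))
        (↭-reflexive (≡-trans (List.++-assoc bs (concatMap g ys) _) (cong (bs ++_) (sym (List.concatMap-++ g ys xs)))))
... | nothing with replaceFirst f xs in rest
replaceFirst-↭ g f bs split (x ∷ xs) refl | nothing | just zs =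
  trans (++⁺ˡ (g x) (replaceFirst-↭ g f bs split xs rest)) (shifts (g x) bs)

tiles? : (d : ℕ) .{{_ : NonZero d}} → List Block → List Block → Bool
tiles? d []       gs = all (λ g → ⌊ proj₂ g ≟ₐ (0 , 0 , 0) ⌋) gs
tiles? d (b ∷ bs) gs with replaceFirst (carve d b) gs
... | just gs′ = tiles? d bs gs′
... | nothing  = false

emptyBlocks : ∀ d gs x y → T (all (λ g → ⌊ proj₂ g ≟ₐ (0 , 0 , 0) ⌋) gs) → concatMap (block d x y) gs ≡ []
emptyBlocks d []             x y _  = refl
emptyBlocks d ((s , l) ∷ gs) x y ok with l ≟ₐ (0 , 0 , 0)
... | yes refl = emptyBlocks d gs x y ok

tiles-↭ : ∀ d .{{_ : NonZero d}} bs gs x y → T (tiles? d bs gs) →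
  concatMap (block d x y) bs ↭ concatMap (block d x y) gs
tiles-↭ d []       gs x y ok = ↭-reflexive (sym (emptyBlocks d gs x y ok))
tiles-↭ d (b ∷ bs) gs x y ok with replaceFirst (carve d b) gs in eq
... | just gs′ = ↭-sym (trans (replaceFirst-↭ (block d x y) (carve d b) (block d x y b)
                                 (λ g → carveAt-↭ d _ b g x y) gs eq)
                              (++⁺ˡ (block d x y b) (↭-sym (tiles-↭ d bs gs′ x y ok))))

-- Affine expressions written so that they evaluate to exactly the terms used in definitions.
infixl 6 _:+_
infixl 7 _:*_ _*:_

data Expr : Set where
  var₁ var₂ : Expr
  lit       : ℕ → Expr
  _:+_      : Expr → Expr → Expr
  _:*_      : ℕ → Expr → Expr
  _*:_      : Expr → ℕ → Expr

⟦_⟧ₑ : Expr → ℕ → ℕ → ℕ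
⟦ var₁ ⟧ₑ   x y = x
⟦ var₂ ⟧ₑ   x y = y
⟦ lit c ⟧ₑ  x y = c
⟦ e :+ f ⟧ₑ x y = ⟦ e ⟧ₑ x y + ⟦ f ⟧ₑ x y
⟦ k :* e ⟧ₑ x y = k * ⟦ e ⟧ₑ x y
⟦ e *: k ⟧ₑ x y = ⟦ e ⟧ₑ x y * k

normalise : Expr → Affine
normalise var₁     = (0 , 1 , 0)
normalise var₂     = (0 , 0 , 1)
normalise (lit c)  = (c , 0 , 0)
normalise (e :+ f) = normalise e ⊕ normalise f
normalise (k :* e) = k ⊛ normalise e
normalise (e *: k) = k ⊛ normalise e

normalise-sound : ∀ e x y → ⟦ e ⟧ₑ x y ≡ ⟦ normalise e ⟧ x y
normalise-sound var₁     x y = var₁-sound x y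
  where
  var₁-sound : ∀ x y → x ≡ 0 + 1 * x + 0 * y
  var₁-sound = solve-∀
normalise-sound var₂     x y = var₂-sound x y
  where
  var₂-sound : ∀ x y → y ≡ 0 + 0 * x + 1 * y
  var₂-sound = solve-∀
normalise-sound (lit c)  x y = sym (≡-trans (ℕ.+-identityʳ (c + 0)) (ℕ.+-identityʳ c))
normalise-sound (e :+ f) x y = ≡-trans (cong₂ _+_ (normalise-sound e x y) (normalise-sound f x y)) (sym (⟦⊕⟧ (normalise e) _ x y))
normalise-sound (k :* e) x y = ≡-trans (cong (k *_) (normalise-sound e x y)) (sym (⟦⊛⟧ k (normalise e) x y))
normalise-sound (e *: k) x y =
  ≡-trans (ℕ.*-comm (⟦ e ⟧ₑ x y) k) (≡-trans (cong (k *_) (normalise-sound e x y)) (sym (⟦⊛⟧ k (normalise e) x y)))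

blockₑ : ℕ → ℕ → ℕ → Expr × Expr → List ℕ
blockₑ d x y (s , l) = progression d (⟦ s ⟧ₑ x y) (⟦ l ⟧ₑ x y)

normaliseBlock : Expr × Expr → Block
normaliseBlock (s , l) = (normalise s , normalise l)

-- No trailing [] after the last block, so that blocksₑ unfolds to the lists used in definitions.
blocksₑ : ℕ → ℕ → ℕ → List (Expr × Expr) → List ℕ
blocksₑ d x y []           = []
blocksₑ d x y (b ∷ [])     = blockₑ d x y b
blocksₑ d x y (b ∷ c ∷ bs) = blockₑ d x y b ++ blocksₑ d x y (c ∷ bs)

blocksₑ-normalise : ∀ d x y bs → blocksₑ d x y bs ≡ concatMap (block d x y) (map normaliseBlock bs)
blocksₑ-normalise d x y []                 = refl
blocksₑ-normalise d x y ((s , l) ∷ [])     =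
  ≡-trans (cong₂ (progression d) (normalise-sound s x y) (normalise-sound l x y)) (sym (List.++-identityʳ _))
blocksₑ-normalise d x y ((s , l) ∷ c ∷ bs) =
  cong₂ _++_ (cong₂ (progression d) (normalise-sound s x y) (normalise-sound l x y)) (blocksₑ-normalise d x y (c ∷ bs))

tilesₑ-↭ : ∀ d .{{_ : NonZero d}} bs gs x y → T (tiles? d (map normaliseBlock bs) (map normaliseBlock gs)) →
  blocksₑ d x y bs ↭ blocksₑ d x y gs
tilesₑ-↭ d bs gs x y ok =
  trans (↭-reflexive (blocksₑ-normalise d x y bs))
        (trans (tiles-↭ d (map normaliseBlock bs) (map normaliseBlock gs) x y ok) (↭-reflexive (sym (blocksₑ-normalise d x y gs))))

-- Skolem sequences

↭-by-sorting : ∀ xs ys → sort xs ≡ ys → xs ↭ ys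
↭-by-sorting xs ys eq = trans (↭-sym (sort-↭ xs)) (↭-reflexive eq)

-- A Skolem pair (d , a) is the pair of positions {a, a + d}.
differences : List (ℕ × ℕ) → List ℕ
differences = map proj₁

pairEnds : ℕ × ℕ → List ℕ
pairEnds (d , a) = a ∷ a + d ∷ []

endpoints : List (ℕ × ℕ) → List ℕ
endpoints = concatMap pairEnds

nestedPairs : ℕ → ℕ → ℕ → List (ℕ × ℕ)
nestedPairs a e zero    = []
nestedPairs a e (suc l) = (suc (e + 2 * l) , a) ∷ nestedPairs (suc a) e l

nestedPairs-differences : ∀ a e l → differences (nestedPairs a e l) ↭ progression 2 (suc e) l
nestedPairs-differences a e zero    = refl
nestedPairs-differences a e (suc l) =
  trans (prep _ (nestedPairs-differences (suc a) e l))
        (trans (∷↭∷ʳ _ (progression 2 (suc e) l))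
               (↭-reflexive (≡-trans (progression-++ 2 (suc e) l 1) (cong (progression 2 (suc e)) (ℕ.+-comm l 1)))))

nestedPairs-endpoints : ∀ a e l → endpoints (nestedPairs a e l) ↭ interval a l ++ interval (a + l + e) l
nestedPairs-endpoints a e zero    = refl
nestedPairs-endpoints a e (suc l) =
  prep a (trans (prep _ (nestedPairs-endpoints (suc a) e l))
                (trans (∷↭∷ʳ _ _)
                       (↭-reflexive (≡-trans (List.++-assoc (interval (suc a) l) _ _)
                         (cong (interval (suc a) l ++_)
                           (≡-trans (cong₂ (λ b c → interval b l ∷ʳ c) (inner a e l) (outer a e l))
                                    (interval-∷ʳ (a + suc l + e) l)))))))
  where
  inner : ∀ a e l → suc a + l + e ≡ a + suc l + e
  inner = solve-∀
  outer : ∀ a e l → a + suc (e + 2 * l) ≡ a + suc l + e + l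
  outer = solve-∀

-- A family of nested pair systems, affine in a parameter m: (start, gap, count).
NestedSpec : Set
NestedSpec = Affine × Affine × Affine

nested : ℕ → NestedSpec → List (ℕ × ℕ)
nested m (a , e , l) = nestedPairs (⟦ a ⟧ m 0) (⟦ e ⟧ m 0) (⟦ l ⟧ m 0)

endpointBlocks : NestedSpec → List Block
endpointBlocks (a , e , l) = (a , l) ∷ (a ⊕ l ⊕ e , l) ∷ []

differenceBlock : NestedSpec → Block
differenceBlock (a , e , l) = (e ⊕ (1 , 0 , 0) , l)

nested-endpoints : ∀ m sp → endpoints (nested m sp) ↭ concatMap (block 1 m 0) (endpointBlocks sp)
nested-endpoints m sp@(a , e , l) =
  trans (nestedPairs-endpoints (⟦ a ⟧ m 0) (⟦ e ⟧ m 0) (⟦ l ⟧ m 0))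
        (↭-reflexive (cong (interval (⟦ a ⟧ m 0) (⟦ l ⟧ m 0) ++_)
          (≡-trans (cong (λ b → interval b (⟦ l ⟧ m 0)) (sym (≡-trans (⟦⊕⟧ (a ⊕ l) e m 0) (cong (_+ ⟦ e ⟧ m 0) (⟦⊕⟧ a l m 0)))))
                   (sym (List.++-identityʳ _)))))

nested-differences : ∀ m sp → differences (nested m sp) ↭ block 2 m 0 (differenceBlock sp)
nested-differences m (a , e , l) =
  trans (nestedPairs-differences (⟦ a ⟧ m 0) (⟦ e ⟧ m 0) (⟦ l ⟧ m 0))
        (↭-reflexive (cong (λ b → progression 2 b (⟦ l ⟧ m 0)) (≡-trans (ℕ.+-comm 1 (⟦ e ⟧ m 0)) (sym (⟦⊕⟧ e (1 , 0 , 0) m 0)))))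

family-endpoints : ∀ m sps segs → T (tiles? 1 (concatMap endpointBlocks sps) segs) →
  endpoints (concatMap (nested m) sps) ↭ concatMap (block 1 m 0) segs
family-endpoints m sps segs ok = trans (pieces sps) (tiles-↭ 1 (concatMap endpointBlocks sps) segs m 0 ok)
  where
  pieces : ∀ sps → endpoints (concatMap (nested m) sps) ↭ concatMap (block 1 m 0) (concatMap endpointBlocks sps)
  pieces []         = refl
  pieces (sp ∷ sps) =
    trans (↭-reflexive (List.concatMap-++ pairEnds (nested m sp) _))
          (trans (++⁺ (nested-endpoints m sp) (pieces sps))
                 (↭-reflexive (sym (List.concatMap-++ (block 1 m 0) (endpointBlocks sp) (concatMap endpointBlocks sps)))))

family-differences : ∀ m sps segs → T (tiles? 2 (map differenceBlock sps) segs) →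
  differences (concatMap (nested m) sps) ↭ concatMap (block 2 m 0) segs
family-differences m sps segs ok = trans (pieces sps) (tiles-↭ 2 (map differenceBlock sps) segs m 0 ok)
  where
  pieces : ∀ sps → differences (concatMap (nested m) sps) ↭ concatMap (block 2 m 0) (map differenceBlock sps)
  pieces []         = refl
  pieces (sp ∷ sps) = trans (↭-reflexive (List.map-++ proj₁ (nested m sp) _)) (++⁺ (nested-differences m sp) (pieces sps))

-- Skolem sequences of order 8 + 4m, 9 + 4m, 10 + 4m and 7 + 4m.
spec₀ spec₁ spec₂ spec₃ : List NestedSpec
spec₀ = ((7 , 4 , 0) , (1 , 0 , 0) , (4 , 2 , 0)) ∷ ((0 , 0 , 0) , (4 , 2 , 0) , (1 , 1 , 0)) ∷ ((3 , 1 , 0) , (2 , 0 , 0) , (0 , 1 , 0)) ∷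
        ((1 , 1 , 0) , (0 , 0 , 0) , (1 , 0 , 0)) ∷ ((3 , 2 , 0) , (2 , 2 , 0) , (1 , 0 , 0)) ∷ ((4 , 2 , 0) , (6 , 4 , 0) , (1 , 0 , 0)) ∷ []
spec₁ = ((9 , 4 , 0) , (1 , 0 , 0) , (4 , 2 , 0)) ∷ ((0 , 0 , 0) , (4 , 2 , 0) , (2 , 1 , 0)) ∷ ((4 , 1 , 0) , (2 , 0 , 0) , (0 , 1 , 0)) ∷
        ((2 , 1 , 0) , (0 , 0 , 0) , (1 , 0 , 0)) ∷ ((4 , 2 , 0) , (8 , 4 , 0) , (1 , 0 , 0)) ∷ ((5 , 2 , 0) , (2 , 2 , 0) , (1 , 0 , 0)) ∷ []
spec₂ = ((0 , 0 , 0) , (1 , 0 , 0) , (5 , 2 , 0)) ∷ ((11 , 5 , 0) , (2 , 0 , 0) , (2 , 1 , 0)) ∷ ((11 , 4 , 0) , (8 , 2 , 0) , (0 , 1 , 0)) ∷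
        ((17 , 7 , 0) , (0 , 0 , 0) , (1 , 0 , 0)) ∷ ((13 , 6 , 0) , (6 , 2 , 0) , (1 , 0 , 0)) ∷ ((5 , 2 , 0) , (8 , 4 , 0) , (1 , 0 , 0)) ∷ []
spec₃ = ((0 , 0 , 0) , (1 , 0 , 0) , (3 , 2 , 0)) ∷ ((7 , 4 , 0) , (4 , 2 , 0) , (1 , 1 , 0)) ∷ ((10 , 5 , 0) , (2 , 0 , 0) , (0 , 1 , 0)) ∷
        ((8 , 5 , 0) , (0 , 0 , 0) , (1 , 0 , 0)) ∷ ((11 , 6 , 0) , (2 , 2 , 0) , (1 , 0 , 0)) ∷ ((3 , 2 , 0) , (6 , 4 , 0) , (1 , 0 , 0)) ∷ []

skolemOf : ℕ → ℕ → List (ℕ × ℕ)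
skolemOf 0 1             = (4 , 0) ∷ (2 , 1) ∷ (3 , 2) ∷ (1 , 6) ∷ []
skolemOf 0 (suc (suc m)) = concatMap (nested m) spec₀
skolemOf 1 0             = (1 , 0) ∷ []
skolemOf 1 1             = (5 , 0) ∷ (2 , 1) ∷ (4 , 2) ∷ (3 , 4) ∷ (1 , 8) ∷ []
skolemOf 1 (suc (suc m)) = concatMap (nested m) spec₁
skolemOf 2 0             = (1 , 0) ∷ (2 , 2) ∷ []
skolemOf 2 1             = (6 , 0) ∷ (4 , 1) ∷ (5 , 2) ∷ (1 , 3) ∷ (2 , 8) ∷ (3 , 9) ∷ []
skolemOf 2 (suc (suc m)) = concatMap (nested m) spec₂
skolemOf 3 0             = (3 , 0) ∷ (1 , 1) ∷ (2 , 4) ∷ []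
skolemOf 3 (suc m)       = concatMap (nested m) spec₃
skolemOf _ _             = []

skolemSupport : Bool → ℕ → List ℕ
skolemSupport false n = interval 0 (2 * n)
skolemSupport true  n = interval 0 (pred (2 * n)) ∷ʳ 2 * n

hookedSupport : ∀ {n a b} → suc a ≡ 2 * n → b ≡ 2 * n → interval 0 a ∷ʳ b ≡ skolemSupport true n
hookedSupport {n} a+1≡2n refl = cong (λ a → interval 0 a ∷ʳ 2 * n) (cong pred a+1≡2n)

parities : ∀ l → progression 2 1 l ++ progression 2 2 l ++ [] ↭ interval 1 (l + l)
parities l = ↭-sym (trans (interval-↭-parities 1 l) (↭-reflexive (cong (progression 2 1 l ++_) (sym (List.++-identityʳ _)))))

parities′ : ∀ l → progression 2 1 (suc l) ++ progression 2 2 l ++ [] ↭ interval 1 (suc (l + l))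
parities′ l = ↭-sym (trans (interval-↭-parities′ 1 l) (↭-reflexive (cong (progression 2 1 (suc l) ++_) (sym (List.++-identityʳ _)))))

skolemOf-differences : ∀ r q → r < 4 → differences (skolemOf r q) ↭ interval 1 (r + q * 4)
skolemOf-differences 0 0 _ = refl
skolemOf-differences 0 1 _ = ↭-by-sorting _ _ refl
skolemOf-differences 0 (suc (suc m)) _ =
  trans (family-differences m spec₀ (((1 , 0 , 0) , (4 , 2 , 0)) ∷ ((2 , 0 , 0) , (4 , 2 , 0)) ∷ []) _)
        (trans (parities (4 + 2 * m + 0 * 0)) (↭-reflexive (cong (interval 1) (order m))))
  where
  order : ∀ m → (4 + 2 * m + 0 * 0) + (4 + 2 * m + 0 * 0) ≡ 0 + suc (suc m) * 4
  order = solve-∀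
skolemOf-differences 1 0 _ = refl
skolemOf-differences 1 1 _ = ↭-by-sorting _ _ refl
skolemOf-differences 1 (suc (suc m)) _ =
  trans (family-differences m spec₁ (((1 , 0 , 0) , (5 , 2 , 0)) ∷ ((2 , 0 , 0) , (4 , 2 , 0)) ∷ []) _)
        (trans (parities′ (4 + 2 * m + 0 * 0)) (↭-reflexive (cong (interval 1) (order m))))
  where
  order : ∀ m → suc ((4 + 2 * m + 0 * 0) + (4 + 2 * m + 0 * 0)) ≡ 1 + suc (suc m) * 4
  order = solve-∀
skolemOf-differences 2 0 _ = ↭-by-sorting _ _ refl
skolemOf-differences 2 1 _ = ↭-by-sorting _ _ refl
skolemOf-differences 2 (suc (suc m)) _ =
  trans (family-differences m spec₂ (((1 , 0 , 0) , (5 , 2 , 0)) ∷ ((2 , 0 , 0) , (5 , 2 , 0)) ∷ []) _)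
        (trans (parities (5 + 2 * m + 0 * 0)) (↭-reflexive (cong (interval 1) (order m))))
  where
  order : ∀ m → (5 + 2 * m + 0 * 0) + (5 + 2 * m + 0 * 0) ≡ 2 + suc (suc m) * 4
  order = solve-∀
skolemOf-differences 3 0 _ = ↭-by-sorting _ _ refl
skolemOf-differences 3 (suc m) _ =
  trans (family-differences m spec₃ (((1 , 0 , 0) , (4 , 2 , 0)) ∷ ((2 , 0 , 0) , (3 , 2 , 0)) ∷ []) _)
        (trans (parities′ (3 + 2 * m + 0 * 0)) (↭-reflexive (cong (interval 1) (order m))))
  where
  order : ∀ m → suc ((3 + 2 * m + 0 * 0) + (3 + 2 * m + 0 * 0)) ≡ 3 + suc m * 4
  order = solve-∀
skolemOf-differences (suc (suc (suc (suc _)))) _ (s≤s (s≤s (s≤s (s≤s ()))))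

skolemOf-endpoints : ∀ r q → r < 4 → endpoints (skolemOf r q) ↭ skolemSupport (2 ≤ᵇ r) (r + q * 4)
skolemOf-endpoints 0 0 _ = refl
skolemOf-endpoints 0 1 _ = ↭-by-sorting _ _ refl
skolemOf-endpoints 0 (suc (suc m)) _ =
  trans (family-endpoints m spec₀ (((0 , 0 , 0) , (16 , 8 , 0)) ∷ []) _)
        (↭-reflexive (≡-trans (List.++-identityʳ _) (cong (interval 0) (size m))))
  where
  size : ∀ m → 16 + 8 * m + 0 * 0 ≡ 2 * (0 + suc (suc m) * 4)
  size = solve-∀
skolemOf-endpoints 1 0 _ = refl
skolemOf-endpoints 1 1 _ = ↭-by-sorting _ _ refl
skolemOf-endpoints 1 (suc (suc m)) _ =
  trans (family-endpoints m spec₁ (((0 , 0 , 0) , (18 , 8 , 0)) ∷ []) _)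
        (↭-reflexive (≡-trans (List.++-identityʳ _) (cong (interval 0) (size m))))
  where
  size : ∀ m → 18 + 8 * m + 0 * 0 ≡ 2 * (1 + suc (suc m) * 4)
  size = solve-∀
skolemOf-endpoints 2 0 _ = ↭-by-sorting _ _ refl
skolemOf-endpoints 2 1 _ = ↭-by-sorting _ _ refl
skolemOf-endpoints 2 (suc (suc m)) _ =
  trans (family-endpoints m spec₂ (((0 , 0 , 0) , (19 , 8 , 0)) ∷ ((20 , 8 , 0) , (1 , 0 , 0)) ∷ []) _)
        (↭-reflexive (hookedSupport {2 + suc (suc m) * 4} (size m) (size′ m)))
  where
  size : ∀ m → suc (19 + 8 * m + 0 * 0) ≡ 2 * (2 + suc (suc m) * 4)
  size = solve-∀
  size′ : ∀ m → 20 + 8 * m + 0 * 0 ≡ 2 * (2 + suc (suc m) * 4)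
  size′ = solve-∀
skolemOf-endpoints 3 0 _ = ↭-by-sorting _ _ refl
skolemOf-endpoints 3 (suc m) _ =
  trans (family-endpoints m spec₃ (((0 , 0 , 0) , (13 , 8 , 0)) ∷ ((14 , 8 , 0) , (1 , 0 , 0)) ∷ []) _)
        (↭-reflexive (hookedSupport {3 + suc m * 4} (size m) (size′ m)))
  where
  size : ∀ m → suc (13 + 8 * m + 0 * 0) ≡ 2 * (3 + suc m * 4)
  size = solve-∀
  size′ : ∀ m → 14 + 8 * m + 0 * 0 ≡ 2 * (3 + suc m * 4)
  size′ = solve-∀
skolemOf-endpoints (suc (suc (suc (suc _)))) _ (s≤s (s≤s (s≤s (s≤s ()))))

hooked : ℕ → Bool
hooked n = 2 ≤ᵇ n % 4

skolem : ℕ → List (ℕ × ℕ)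
skolem n = skolemOf (n % 4) (n / 4)

skolem-differences : ∀ n → differences (skolem n) ↭ interval 1 n
skolem-differences n =
  subst (λ k → differences (skolem n) ↭ interval 1 k) (sym (m≡m%n+[m/n]*n n 4)) (skolemOf-differences (n % 4) (n / 4) (m%n<n n 4))

skolem-endpoints : ∀ n → endpoints (skolem n) ↭ skolemSupport (hooked n) n
skolem-endpoints n =
  subst (λ k → endpoints (skolem n) ↭ skolemSupport (hooked n) k) (sym (m≡m%n+[m/n]*n n 4)) (skolemOf-endpoints (n % 4) (n / 4) (m%n<n n 4))

startOf : List (ℕ × ℕ) → ℕ → ℕ
startOf []             d = 0
startOf ((d′ , a) ∷ ps) d = if does (d′ ≟ d) then a else startOf ps d

startOf-pairs : ∀ ps → Unique (differences ps) → map (λ d → d , startOf ps d) (differences ps) ≡ ps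
startOf-pairs []              _              = refl
startOf-pairs ((d , a) ∷ ps) (d∉ ∷ unique) =
  cong₂ _∷_ (cong (λ b → d , (if b then a else startOf ps d)) (dec-true (d ≟ d) refl))
            (≡-trans (List.map-cong-local (All.map skip d∉)) (startOf-pairs ps unique))
  where
  skip : ∀ {d′} → d ≢ d′ → (d′ , startOf ((d , a) ∷ ps) d′) ≡ (d′ , startOf ps d′)
  skip {d′} d≢d′ = cong (λ b → d′ , (if b then a else startOf ps d′)) (dec-false (d ≟ d′) d≢d′)

startOf-↭ : ∀ ps ds → Unique (differences ps) → ds ↭ differences ps → map (λ d → d , startOf ps d) ds ↭ ps
startOf-↭ ps ds unique ds↭ = trans (map⁺ _ ds↭) (↭-reflexive (startOf-pairs ps unique))

-- Signs at the centre

signed : Bool → ℕ → ℤ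
signed true  m = + m
signed false m = - + m

signedSum : (ℕ → Bool) → ℕ → ℤ
signedSum σ n = sumℤ (map (λ c → signed (σ c) c) (interval 1 n))

blockSigns : ℕ → Bool
blockSigns 1 = true
blockSigns 4 = true
blockSigns _ = false

-- Keep σ up to m and give m + 1, …, m + 4 the signs + − − +, which cancel.
extendSigns : ℕ → (ℕ → Bool) → ℕ → Bool
extendSigns m σ c = if does (c ≤? m) then σ c else blockSigns (c ∸ m)

extendSigns-sum : ∀ m σ → signedSum (extendSigns m σ) (m + 4) ≡ signedSum σ m
extendSigns-sum m σ = begin
  sumℤ (map term′ (interval 1 (m + 4)))                                 ≡⟨ cong (sumℤ ∘ map term′) (interval-++ 1 m 4) ⟨
  sumℤ (map term′ (interval 1 m ++ interval (suc m) 4))                  ≡⟨ sumℤ-map-++ term′ (interval 1 m) _ ⟩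
  sumℤ (map term′ (interval 1 m)) ℤ.+ sumℤ (map term′ (interval (suc m) 4))
    ≡⟨ cong₂ ℤ._+_ (cong sumℤ (List.map-cong-local (All.tabulate below))) top ⟩
  signedSum σ m ℤ.+ + 0                                                  ≡⟨ ℤ.+-identityʳ _ ⟩
  signedSum σ m                                                          ∎
  where
  open ≡-Reasoning
  term′ : ℕ → ℤ
  term′ c = signed (extendSigns m σ c) c
  below : ∀ {c} → c ∈ interval 1 m → term′ c ≡ signed (σ c) c
  below {c} c∈ = cong (λ b → signed (if b then σ c else blockSigns (c ∸ m)) c) (dec-true (c ≤? m) (ℕ.≤-pred (proj₂ (∈-interval⁻ c∈))))
  above : ∀ k → term′ (suc k + m) ≡ signed (blockSigns (suc k)) (suc k + m)
  above k = cong₂ (λ b j → signed (if b then σ (suc k + m) else blockSigns j) (suc k + m))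
                  (dec-false (suc k + m ≤? m) (ℕ.<⇒≱ (ℕ.m<n+m m (s≤s z≤n)))) (ℕ.m+n∸n≡m (suc k) m)
  cancel : ∀ (M : ℤ) → (+ 1 ℤ.+ M) ℤ.+ (- (+ 2 ℤ.+ M) ℤ.+ (- (+ 3 ℤ.+ M) ℤ.+ ((+ 4 ℤ.+ M) ℤ.+ + 0))) ≡ + 0
  cancel = ℤ-Solver.solve-∀
  top : sumℤ (map term′ (interval (suc m) 4)) ≡ + 0
  top = ≡-trans (cong₂ ℤ._+_ (above 0) (cong₂ ℤ._+_ (above 1) (cong₂ ℤ._+_ (above 2) (cong (ℤ._+ + 0) (above 3)))))
                (cancel (+ m))

centreSigns : ∀ n → 1 ≤ n → Σ (ℕ → Bool) λ σ → signedSum σ n ≡ + 1 ⊎ signedSum σ n ≡ + 2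
centreSigns 1 _ = (λ _ → true) , inj₁ refl
centreSigns 2 _ = (λ c → not (c ≡ᵇ 1)) , inj₁ refl
centreSigns 3 _ = (λ c → not (c ≡ᵇ 2)) , inj₂ refl
centreSigns 4 _ = (λ c → (c ≡ᵇ 2) ∨ (c ≡ᵇ 4)) , inj₂ refl
centreSigns (suc (suc (suc (suc (suc n))))) _ with σ , sum ← centreSigns (suc n) (s≤s z≤n) =
  extendSigns (suc n) σ , Data.Sum.map (≡-trans extendSigns-sum′) (≡-trans extendSigns-sum′) sum
  where
  extendSigns-sum′ : signedSum (extendSigns (suc n) σ) (5 + n) ≡ signedSum σ (suc n)
  extendSigns-sum′ = ≡-trans (cong (signedSum (extendSigns (suc n) σ)) (ℕ.+-comm 4 (suc n))) (extendSigns-sum (suc n) σ)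

arc : Bool → ℕ → ℕ → List (ℕ × Bool)
arc b a d = (a , not b) ∷ (a + d , b) ∷ []

-- A leaf at position p carries the label A + p; the flag says whether it enters the star centre.
legWeight : ℕ → ℕ × Bool → ℤ
legWeight A (p , entering) = signed entering (A + p)

arc-weight : ∀ A b a d → sumℤ (map (legWeight A) (arc b a d)) ≡ signed b d
arc-weight A true  a d = gain (+ A) (+ a) (+ d)
  where
  gain : ∀ (A a d : ℤ) → - (A ℤ.+ a) ℤ.+ (A ℤ.+ (a ℤ.+ d) ℤ.+ + 0) ≡ d
  gain = ℤ-Solver.solve-∀
arc-weight A false a d = loss (+ A) (+ a) (+ d)
  where
  loss : ∀ (A a d : ℤ) → A ℤ.+ a ℤ.+ (- (A ℤ.+ (a ℤ.+ d)) ℤ.+ + 0) ≡ - d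
  loss = ℤ-Solver.solve-∀

data Kind : Set where
  plus minus minusʳ : Kind

-- A K_{1,5} star built on the Skolem pair of difference `diff` and the extra pair
-- {extra, extra + gap}; its centre gets the label diff + gap, diff - gap or gap - diff by kind.
record K15 : Set where
  constructor k15
  field
    kind             : Kind
    diff extra gap   : ℕ

open K15 public

value : K15 → ℕ
value (k15 plus   d _ g) = d + g
value (k15 minus  d _ g) = d ∸ g
value (k15 minusʳ d _ g) = g ∸ d

Valid : K15 → Set
Valid (k15 plus   _ _ _) = ⊤
Valid (k15 minus  d _ g) = g ≤ d
Valid (k15 minusʳ d _ g) = d ≤ g

extraEnds : K15 → List ℕ
extraEnds (k15 _ _ q g) = q ∷ q + g ∷ []

diffSign gapSign : Kind → Bool
diffSign minusʳ = false
diffSign _      = true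
gapSign minus  = false
gapSign _      = true

k15-value : ∀ s → Valid s → signed (diffSign (kind s)) (diff s) ℤ.+ signed (gapSign (kind s)) (gap s) ≡ + value s
k15-value (k15 plus   d _ g) _   = refl
k15-value (k15 minus  d _ g) g≤d = ≡-trans (ℤ.m-n≡m⊖n d g) (ℤ.⊖-≥ g≤d)
k15-value (k15 minusʳ d _ g) d≤g = ≡-trans (ℤ.+-comm (- + d) (+ g)) (≡-trans (ℤ.m-n≡m⊖n g d) (ℤ.⊖-≥ d≤g))

-- star₃ d is the K_{1,3} on the Skolem pair of difference d.
data Star : Set where
  star₃ : ℕ → Star
  star₅ : K15 → Star

valueOf : Star → ℕ
valueOf (star₃ d) = d
valueOf (star₅ s) = value s

differenceOf : Star → ℕ
differenceOf (star₃ d) = d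
differenceOf (star₅ s) = diff s

ValidStar : Star → Set
ValidStar (star₃ _) = ⊤
ValidStar (star₅ s) = Valid s

extrasOf : Star → List ℕ
extrasOf (star₃ _) = []
extrasOf (star₅ s) = extraEnds s

legsOf : (ℕ → ℕ) → Star → List (ℕ × Bool)
legsOf start (star₃ d) = arc true (start d) d
legsOf start (star₅ s) = arc (diffSign (kind s)) (start (diff s)) (diff s) ++ arc (gapSign (kind s)) (extra s) (gap s)

legsOf-weight : ∀ A (start : ℕ → ℕ) st → ValidStar st → sumℤ (map (legWeight A) (legsOf start st)) ≡ + valueOf st
legsOf-weight A start (star₃ d) _     = arc-weight A true (start d) d
legsOf-weight A start (star₅ s) valid =
  ≡-trans (sumℤ-map-++ (legWeight A) (arc (diffSign (kind s)) (start (diff s)) (diff s)) (arc (gapSign (kind s)) (extra s) (gap s)))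
          (≡-trans (cong₂ ℤ._+_ (arc-weight A (diffSign (kind s)) (start (diff s)) (diff s)) (arc-weight A (gapSign (kind s)) (extra s) (gap s)))
                   (k15-value s valid))

legsOf-positions : ∀ (start : ℕ → ℕ) st → map proj₁ (legsOf start st) ≡ pairEnds (differenceOf st , start (differenceOf st)) ++ extrasOf st
legsOf-positions start (star₃ d) = refl
legsOf-positions start (star₅ s) = refl

-- 2h stars on the pairs {p + 2i, p + 2i + 1}; consecutive ones exchange the values a + 2j and a + 2j + 1.
swaps : ℕ → ℕ → ℕ → List K15
swaps a p zero    = []
swaps a p (suc h) = k15 plus a p 1 ∷ k15 minus (suc a) (2 + p) 1 ∷ swaps (2 + a) (4 + p) h

swaps-values : ∀ a p h → map value (swaps a p h) ↭ interval a (h * 2)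
swaps-values a p zero    = refl
swaps-values a p (suc h) =
  trans (↭-reflexive (cong (λ b → b ∷ a ∷ map value (swaps (2 + a) (4 + p) h)) (ℕ.+-comm a 1)))
        (swap (suc a) a (swaps-values (2 + a) (4 + p) h))

swaps-diffs : ∀ a p h → map diff (swaps a p h) ≡ interval a (h * 2)
swaps-diffs a p zero    = refl
swaps-diffs a p (suc h) = cong (λ l → a ∷ suc a ∷ l) (swaps-diffs (2 + a) (4 + p) h)

swaps-extraEnds : ∀ a p h → concatMap extraEnds (swaps a p h) ≡ interval p (h * 4)
swaps-extraEnds a p zero    = refl
swaps-extraEnds a p (suc h) =
  ≡-trans (cong₂ (λ b c → p ∷ b ∷ 2 + p ∷ c ∷ concatMap extraEnds (swaps (2 + a) (4 + p) h)) (ℕ.+-comm p 1) (ℕ.+-comm (2 + p) 1))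
          (cong (λ l → p ∷ suc p ∷ 2 + p ∷ 3 + p ∷ l) (swaps-extraEnds (2 + a) (4 + p) h))

swaps-valid : ∀ a p h → All Valid (swaps a p h)
swaps-valid a p zero    = []
swaps-valid a p (suc h) = tt ∷ s≤s z≤n ∷ swaps-valid (2 + a) (4 + p) h

-- The K_{1,5} stars for n₂ = r + 2h; w = 2n - 1 is the last position of a Skolem sequence of order n.
k15Stars : Bool → ℕ → ℕ → ℕ → List K15
k15Stars false w 0 h             = swaps 1 (suc w) h
k15Stars false w 1 h             = k15 minusʳ 1 (suc w + h * 4) 2 ∷ swaps 2 (suc w) h
k15Stars true  w 0 0             = []
k15Stars true  w 0 1             = k15 minusʳ 1 w 3 ∷ k15 minusʳ 2 (2 + w) 3 ∷ []
k15Stars true  w 0 (suc (suc h)) =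
  k15 minusʳ 1 w 2 ∷ k15 plus 2 (3 + w) 1 ∷ k15 plus 3 (5 + w) 1 ∷ k15 minus 4 (7 + w + h * 4) 2 ∷ swaps 5 (7 + w) h
k15Stars true  w 1 h             = k15 minusʳ 1 w 2 ∷ swaps 2 (3 + w) h
k15Stars _     _ _ _             = []

k15Stars-values : ∀ b w r h → r < 2 → map value (k15Stars b w r h) ↭ interval 1 (r + h * 2)
k15Stars-values false w 0 h             _ = swaps-values 1 _ h
k15Stars-values false w 1 h             _ = prep 1 (swaps-values 2 _ h)
k15Stars-values true  w 0 0             _ = refl
k15Stars-values true  w 0 1             _ = swap 2 1 refl
k15Stars-values true  w 0 (suc (suc h)) _ = prep 1 (trans (shift 2 (3 ∷ 4 ∷ []) _) (prep 2 (prep 3 (prep 4 (swaps-values 5 _ h)))))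
k15Stars-values true  w 1 h             _ = prep 1 (swaps-values 2 _ h)
k15Stars-values _     w (suc (suc _)) h (s≤s (s≤s ()))

k15Stars-diffs : ∀ b w r h → r < 2 → map diff (k15Stars b w r h) ≡ interval 1 (r + h * 2)
k15Stars-diffs false w 0 h             _ = swaps-diffs 1 _ h
k15Stars-diffs false w 1 h             _ = cong (1 ∷_) (swaps-diffs 2 _ h)
k15Stars-diffs true  w 0 0             _ = refl
k15Stars-diffs true  w 0 1             _ = refl
k15Stars-diffs true  w 0 (suc (suc h)) _ = cong (λ l → 1 ∷ 2 ∷ 3 ∷ 4 ∷ l) (swaps-diffs 5 _ h)
k15Stars-diffs true  w 1 h             _ = cong (1 ∷_) (swaps-diffs 2 _ h)
k15Stars-diffs _     w (suc (suc _)) h (s≤s (s≤s ()))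

k15Stars-valid : ∀ b w r h → All Valid (k15Stars b w r h)
k15Stars-valid false w 0             h             = swaps-valid 1 _ h
k15Stars-valid false w 1             h             = s≤s z≤n ∷ swaps-valid 2 _ h
k15Stars-valid true  w 0             0             = []
k15Stars-valid true  w 0             1             = s≤s z≤n ∷ s≤s (s≤s z≤n) ∷ []
k15Stars-valid true  w 0             (suc (suc h)) = s≤s z≤n ∷ tt ∷ tt ∷ s≤s (s≤s z≤n) ∷ swaps-valid 5 _ h
k15Stars-valid true  w 1             h             = s≤s z≤n ∷ swaps-valid 2 _ h
k15Stars-valid false w (suc (suc _)) h             = []
k15Stars-valid true  w (suc (suc _)) h             = []

leafPositions : ℕ → ℕ → List ℕ
leafPositions X t = interval 0 X ∷ʳ (X + t)

leafPositions-0 : ∀ X → interval 0 (suc X) ≡ leafPositions X 0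
leafPositions-0 X = ≡-trans (sym (interval-∷ʳ 0 X)) (cong (interval 0 X ∷ʳ_) (sym (ℕ.+-identityʳ X)))

k15Stars-positions : ∀ b n w r h → 2 * n ≡ suc w → r < 2 →
  concatMap extraEnds (k15Stars b w r h) ++ skolemSupport b n ↭ leafPositions (w + 2 * (r + h * 2)) (if b then 1 ∸ r else r)
k15Stars-positions false n w 0 h 2n≡ _ rewrite 2n≡ | swaps-extraEnds 1 (suc w) h =
  trans (tilesₑ-↭ 1 ((lit 1 :+ var₁ , var₂ *: 4) ∷ (lit 0 , lit 1 :+ var₁) ∷ [])
                    ((lit 0 , lit 1 :+ (var₁ :+ 2 :* (lit 0 :+ var₂ *: 2))) ∷ []) w h _)
        (↭-reflexive (leafPositions-0 _))
k15Stars-positions false n w 1 h 2n≡ _ rewrite 2n≡ | swaps-extraEnds 2 (suc w) h =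
  tilesₑ-↭ 1 ((lit 1 :+ var₁ :+ var₂ *: 4 , lit 1) ∷ (lit 1 :+ var₁ :+ var₂ *: 4 :+ lit 2 , lit 1) ∷
              (lit 1 :+ var₁ , var₂ *: 4) ∷ (lit 0 , lit 1 :+ var₁) ∷ [])
             ((lit 0 , X) ∷ (X :+ lit 1 , lit 1) ∷ []) w h _
  where X = var₁ :+ 2 :* (lit 1 :+ var₂ *: 2)
k15Stars-positions true n w 0 0 2n≡ _ rewrite 2n≡ =
  tilesₑ-↭ 1 ((lit 0 , var₁) ∷ (lit 1 :+ var₁ , lit 1) ∷ [])
             ((lit 0 , X) ∷ (X :+ lit 1 , lit 1) ∷ []) w 0 _
  where X = var₁ :+ 2 :* (lit 0 :+ lit 0 *: 2)
k15Stars-positions true n w 0 1 2n≡ _ rewrite 2n≡ =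
  tilesₑ-↭ 1 ((var₁ , lit 1) ∷ (var₁ :+ lit 3 , lit 1) ∷ (lit 2 :+ var₁ , lit 1) ∷ (lit 2 :+ var₁ :+ lit 3 , lit 1) ∷
              (lit 0 , var₁) ∷ (lit 1 :+ var₁ , lit 1) ∷ [])
             ((lit 0 , X) ∷ (X :+ lit 1 , lit 1) ∷ []) w 0 _
  where X = var₁ :+ 2 :* (lit 0 :+ lit 1 *: 2)
k15Stars-positions true n w 0 (suc (suc h)) 2n≡ _ rewrite 2n≡ | swaps-extraEnds 5 (7 + w) h =
  tilesₑ-↭ 1 ((var₁ , lit 1) ∷ (var₁ :+ lit 2 , lit 1) ∷ (lit 3 :+ var₁ , lit 1) ∷ (lit 3 :+ var₁ :+ lit 1 , lit 1) ∷
              (lit 5 :+ var₁ , lit 1) ∷ (lit 5 :+ var₁ :+ lit 1 , lit 1) ∷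
              (lit 7 :+ var₁ :+ var₂ *: 4 , lit 1) ∷ (lit 7 :+ var₁ :+ var₂ *: 4 :+ lit 2 , lit 1) ∷
              (lit 7 :+ var₁ , var₂ *: 4) ∷ (lit 0 , var₁) ∷ (lit 1 :+ var₁ , lit 1) ∷ [])
             ((lit 0 , X) ∷ (X :+ lit 1 , lit 1) ∷ []) w h _
  where X = var₁ :+ 2 :* (lit 0 :+ (lit 2 :+ var₂) *: 2)
k15Stars-positions true n w 1 h 2n≡ _ rewrite 2n≡ | swaps-extraEnds 2 (3 + w) h =
  trans (tilesₑ-↭ 1 ((var₁ , lit 1) ∷ (var₁ :+ lit 2 , lit 1) ∷ (lit 3 :+ var₁ , var₂ *: 4) ∷
                     (lit 0 , var₁) ∷ (lit 1 :+ var₁ , lit 1) ∷ [])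
                    ((lit 0 , lit 1 :+ (var₁ :+ 2 :* (lit 1 :+ var₂ *: 2))) ∷ []) w h _)
        (↭-reflexive (leafPositions-0 _))
k15Stars-positions b n w (suc (suc _)) h _ (s≤s (s≤s ()))

module Snowflake (n₁ n₂ : ℕ) where

  private
    n = n₁ + n₂

  edges-complete : ∀ e → e ∈ edges n₁ n₂
  edges-complete (i , j) =
    ∈-concatMap⁺ (λ i → map (i ,_) (allFin (deg n₁ n₂ i))) (Any.map (λ { refl → ∈-map⁺ (i ,_) (∈-allFin j) }) (∈-allFin i))

  -- vsum o φ u is by definition sumℤ (map (flow o φ u) (edges n₁ n₂)).
  flow : Orientation n₁ n₂ → (Edge n₁ n₂ → ℕ) → Vertex n₁ n₂ → Edge n₁ n₂ → ℤ
  flow o φ u e = (if eqV (head o e) u then + φ e else + 0) ℤ.- (if eqV (tail o e) u then + φ e else + 0)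

  starSum : (Edge n₁ n₂ → ℤ) → Fin n → ℤ
  starSum F i = F (i , zero) ℤ.+ sumℤ (map (λ j → F (i , suc j)) (allFin (degm1 n₁ n₂ i)))

  sumℤ-edges : (F : Edge n₁ n₂ → ℤ) → sumℤ (map F (edges n₁ n₂)) ≡ sumℤ (map (starSum F) (allFin n))
  sumℤ-edges F = begin
    sumℤ (map F (edges n₁ n₂))                                                  ≡⟨ cong sumℤ (List.map-concatMap F _ (allFin n)) ⟩
    sumℤ (concatMap (λ i → map F (map (i ,_) (allFin (deg n₁ n₂ i)))) (allFin n)) ≡⟨ sumℤ-concatMap _ (allFin n) ⟩
    sumℤ (map (λ i → sumℤ (map F (map (i ,_) (allFin (deg n₁ n₂ i))))) (allFin n)) ≡⟨ cong sumℤ (List.map-cong star (allFin n)) ⟩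
    sumℤ (map (starSum F) (allFin n))                                            ∎
    where
    open ≡-Reasoning
    star : ∀ i → sumℤ (map F (map (i ,_) (allFin (deg n₁ n₂ i)))) ≡ starSum F i
    star i = cong (λ l → F (i , zero) ℤ.+ sumℤ l) (≡-trans (sym (List.map-∘ (tabulate suc))) (map-allFin-suc (F ∘ (i ,_))))

  eqV-self : ∀ i → eqV {n₁} {n₂} (ctr i) (ctr i) ≡ true
  eqV-self i with i Fin.≟ i
  ... | yes _   = refl
  ... | no  i≢i = ⊥-elim (i≢i refl)

  eqV-distinct : ∀ i i₀ → i ≢ i₀ → eqV {n₁} {n₂} (ctr i) (ctr i₀) ≡ false
  eqV-distinct i i₀ i≢i₀ with i Fin.≟ i₀
  ... | yes i≡i₀ = ⊥-elim (i≢i₀ i≡i₀)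
  ... | no  _    = refl

  eqV-other : ∀ (e : Edge n₁ n₂) i → eqV (other {n₁} {n₂} e) (ctr i) ≡ false
  eqV-other (_ , zero)  i = refl
  eqV-other (_ , suc _) i = refl

  flow-cong : ∀ {a a′ b b′ : Bool} x → a ≡ a′ → b ≡ b′ →
    (if a then + x else + 0) ℤ.- (if b then + x else + 0) ≡ (if a′ then + x else + 0) ℤ.- (if b′ then + x else + 0)
  flow-cong x refl refl = refl

  flow-own : ∀ o φ i j → flow o φ (ctr i) (i , j) ≡ signed (not (o (i , j))) (φ (i , j))
  flow-own o φ i j with o (i , j)
  ... | true  = ≡-trans (flow-cong (φ (i , j)) (eqV-other (i , j) i) (eqV-self i)) (ℤ.+-identityˡ _)
  ... | false = ≡-trans (flow-cong (φ (i , j)) (eqV-self i) (eqV-other (i , j) i)) (ℤ.+-identityʳ _)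

  flow-away : ∀ o φ i j i₀ → i ≢ i₀ → flow o φ (ctr i₀) (i , j) ≡ + 0
  flow-away o φ i j i₀ i≢i₀ with o (i , j)
  ... | true  = flow-cong (φ (i , j)) (eqV-other (i , j) i₀) (eqV-distinct i i₀ i≢i₀)
  ... | false = flow-cong (φ (i , j)) (eqV-distinct i i₀ i≢i₀) (eqV-other (i , j) i₀)

  flow-hub-spoke : ∀ o φ i → flow o φ hub (i , zero) ≡ signed (o (i , zero)) (φ (i , zero))
  flow-hub-spoke o φ i with o (i , zero)
  ... | true  = ℤ.+-identityʳ _
  ... | false = ℤ.+-identityˡ _

  flow-hub-leaf : ∀ o φ i j → flow o φ hub (i , suc j) ≡ + 0
  flow-hub-leaf o φ i j with o (i , suc j)
  ... | true  = refl
  ... | false = refl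

module Labelling (n₁ n₂ : ℕ) (A : ℕ) (σ : ℕ → Bool)
  (spokeLabel : Fin (n₁ + n₂) → ℕ) (legs : Fin (n₁ + n₂) → List (ℕ × Bool))
  (legs-length : ∀ i → length (legs i) ≡ degm1 n₁ n₂ i) where

  open Snowflake n₁ n₂

  private
    n = n₁ + n₂

  leg : (i : Fin n) → Fin (degm1 n₁ n₂ i) → ℕ × Bool
  leg i j = lookup (legs i) (cast (sym (legs-length i)) j)

  φ : Edge n₁ n₂ → ℕ
  φ (i , zero)  = spokeLabel i
  φ (i , suc j) = A + proj₁ (leg i j)

  -- σ c orients the spoke of the star labelled c towards the hub; when it points away,
  -- all legs of that star are reversed.
  o : Orientation n₁ n₂
  o (i , zero)  = σ (spokeLabel i)
  o (i , suc j) = σ (spokeLabel i) xor proj₂ (leg i j)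

  private
    turn : Bool → ℤ → ℤ
    turn true  z = z
    turn false z = - z

    turn-sum : ∀ b (xs : List (ℕ × Bool)) → sumℤ (map (turn b ∘ legWeight A) xs) ≡ turn b (sumℤ (map (legWeight A) xs))
    turn-sum true  xs = cong sumℤ (List.map-cong (λ _ → refl) xs)
    turn-sum false xs = sumℤ-neg (legWeight A) xs

    leg-flow : ∀ b ℓ → signed (not (b xor proj₂ ℓ)) (A + proj₁ ℓ) ≡ turn b (legWeight A ℓ)
    leg-flow true  (p , true)  = refl
    leg-flow true  (p , false) = refl
    leg-flow false (p , true)  = refl
    leg-flow false (p , false) = sym (ℤ.neg-involutive _)

    spoke-cancels : ∀ b c → signed (not b) c ℤ.+ turn b (+ c) ≡ + 0
    spoke-cancels true  c = ℤ.+-inverseˡ (+ c)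
    spoke-cancels false c = ℤ.+-inverseʳ (+ c)

  vsum-ctr : (∀ i → sumℤ (map (legWeight A) (legs i)) ≡ + spokeLabel i) → ∀ i → vsum {n₁} {n₂} o φ (ctr i) ≡ + 0
  vsum-ctr balanced i₀ = begin
    vsum {n₁} {n₂} o φ (ctr i₀)                                     ≡⟨ sumℤ-edges (flow o φ (ctr i₀)) ⟩
    sumℤ (map (starSum (flow o φ (ctr i₀))) (allFin n))              ≡⟨ sumℤ-single _ i₀ elsewhere ⟩
    starSum (flow o φ (ctr i₀)) i₀                                   ≡⟨ cong₂ ℤ._+_ (flow-own o φ i₀ zero) own-legs ⟩
    signed (not s) c ℤ.+ turn s (sumℤ (map (legWeight A) (legs i₀))) ≡⟨ cong (λ z → signed (not s) c ℤ.+ turn s z) (balanced i₀) ⟩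
    signed (not s) c ℤ.+ turn s (+ c)                                ≡⟨ spoke-cancels s c ⟩
    + 0                                                              ∎
    where
    open ≡-Reasoning
    c = spokeLabel i₀
    s = σ c
    elsewhere : ∀ i → i ≢ i₀ → starSum (flow o φ (ctr i₀)) i ≡ + 0
    elsewhere i i≢i₀ = cong₂ ℤ._+_ (flow-away o φ i zero i₀ i≢i₀)
                                   (sumℤ-zero _ (allFin (degm1 n₁ n₂ i)) (λ j → flow-away o φ i (suc j) i₀ i≢i₀))
    own-legs : sumℤ (map (λ j → flow o φ (ctr i₀) (i₀ , suc j)) (allFin (degm1 n₁ n₂ i₀))) ≡ turn s (sumℤ (map (legWeight A) (legs i₀)))
    own-legs = begin
      sumℤ (map (λ j → flow o φ (ctr i₀) (i₀ , suc j)) (allFin (degm1 n₁ n₂ i₀)))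
        ≡⟨ cong sumℤ (List.map-cong (λ j → ≡-trans (flow-own o φ i₀ (suc j)) (leg-flow s (leg i₀ j))) (allFin (degm1 n₁ n₂ i₀))) ⟩
      sumℤ (map (λ j → turn s (legWeight A (leg i₀ j))) (allFin (degm1 n₁ n₂ i₀)))
        ≡⟨ cong sumℤ (map-lookup-cast (turn s ∘ legWeight A) (legs i₀) (sym (legs-length i₀))) ⟩
      sumℤ (map (turn s ∘ legWeight A) (legs i₀))                    ≡⟨ turn-sum s (legs i₀) ⟩
      turn s (sumℤ (map (legWeight A) (legs i₀)))                    ∎

  vsum-hub : map spokeLabel (allFin n) ↭ interval 1 n → vsum {n₁} {n₂} o φ hub ≡ signedSum σ n
  vsum-hub values = begin
    vsum {n₁} {n₂} o φ hub                           ≡⟨ sumℤ-edges (flow o φ hub) ⟩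
    sumℤ (map (starSum (flow o φ hub)) (allFin n))   ≡⟨ cong sumℤ (List.map-cong spoke-only (allFin n)) ⟩
    sumℤ (map (spoke ∘ spokeLabel) (allFin n))       ≡⟨ cong sumℤ (List.map-∘ (allFin n)) ⟩
    sumℤ (map spoke (map spokeLabel (allFin n)))     ≡⟨ sumℤ-↭ (map⁺ spoke values) ⟩
    signedSum σ n                                    ∎
    where
    open ≡-Reasoning
    spoke : ℕ → ℤ
    spoke c = signed (σ c) c
    spoke-only : ∀ i → starSum (flow o φ hub) i ≡ spoke (spokeLabel i)
    spoke-only i = ≡-trans (cong₂ ℤ._+_ (flow-hub-spoke o φ i) (sumℤ-zero _ (allFin (degm1 n₁ n₂ i)) (flow-hub-leaf o φ i)))
                           (ℤ.+-identityʳ _)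

  star-labels : ∀ i → map φ (map (i ,_) (allFin (deg n₁ n₂ i))) ≡ spokeLabel i ∷ map (λ p → A + p) (map proj₁ (legs i))
  star-labels i = cong (spokeLabel i ∷_) (begin
    map φ (map (i ,_) (tabulate suc))                          ≡⟨ List.map-∘ (tabulate suc) ⟨
    map (φ ∘ (i ,_)) (tabulate suc)                            ≡⟨ map-allFin-suc (φ ∘ (i ,_)) ⟩
    map (λ j → A + proj₁ (leg i j)) (allFin (degm1 n₁ n₂ i))   ≡⟨ map-lookup-cast ((λ p → A + p) ∘ proj₁) (legs i) (sym (legs-length i)) ⟩
    map ((λ p → A + p) ∘ proj₁) (legs i)                       ≡⟨ List.map-∘ (legs i) ⟩
    map (λ p → A + p) (map proj₁ (legs i))                     ∎)
    where open ≡-Reasoning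

  labels-↭ : map φ (edges n₁ n₂) ↭ map spokeLabel (allFin n) ++ map (λ p → A + p) (concatMap (map proj₁ ∘ legs) (allFin n))
  labels-↭ = begin
    map φ (edges n₁ n₂)                                                     ≡⟨ List.map-concatMap φ _ (allFin n) ⟩
    concatMap (λ i → map φ (map (i ,_) (allFin (deg n₁ n₂ i)))) (allFin n)  ≡⟨ List.concatMap-cong star-labels (allFin n) ⟩
    concatMap (λ i → spokeLabel i ∷ map (λ p → A + p) (map proj₁ (legs i))) (allFin n)
      ↭⟨ concatMap-∷-↭ spokeLabel _ (allFin n) ⟩
    map spokeLabel (allFin n) ++ concatMap (λ i → map (λ p → A + p) (map proj₁ (legs i))) (allFin n)
      ≡⟨ cong (map spokeLabel (allFin n) ++_) (sym (List.map-concatMap (λ p → A + p) (map proj₁ ∘ legs) (allFin n))) ⟩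
    map spokeLabel (allFin n) ++ map (λ p → A + p) (concatMap (map proj₁ ∘ legs) (allFin n)) ∎
    where open PermutationReasoning

labels : ℕ → ℕ → ℕ → ℕ → List ℕ
labels n A X t = interval 1 n ++ map (λ p → A + p) (leafPositions X t)

leafPositions-unique : ∀ X t → Unique (leafPositions X t)
leafPositions-unique X t =
  Unique.++⁺ (interval-unique 0 X) (All.[] ∷ [])
             (λ { (p∈ , here refl) → ℕ.<⇒≱ (proj₂ (∈-interval⁻ p∈)) (ℕ.m≤m+n X t) })

labels-unique : ∀ n A X t → n < A → Unique (labels n A X t)
labels-unique n A X t n<A =
  Unique.++⁺ (interval-unique 1 n) (Unique.map⁺ (ℕ.+-cancelˡ-≡ A _ _) (leafPositions-unique X t)) disjoint
  where
  disjoint : ∀ {m} → ¬ (m ∈ interval 1 n × m ∈ map (λ p → A + p) (leafPositions X t))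
  disjoint (m∈ , m∈′) with p , _ , refl ← ∈-map⁻ (λ p → A + p) m∈′ =
    ℕ.<⇒≱ (ℕ.≤-trans n<A (ℕ.m≤m+n A p)) (ℕ.≤-pred (proj₂ (∈-interval⁻ m∈)))

private
  <⇒≤∸1 : ∀ {a b} → a < b → a ≤ b ∸ 1
  <⇒≤∸1 (s≤s a≤b) = a≤b

  ≤∸1⇒< : ∀ {a b} → 0 < b → a ≤ b ∸ 1 → a < b
  ≤∸1⇒< {b = suc b} _ a≤b = s≤s a≤b

module _ {n k M X t : ℕ} (size : n + 1 + k + X ≡ M + k) where

  private
    A = n + 1 + k

  ∈-labels⇒InLabels : ∀ {m} → m ∈ labels n A X t → InLabels n k M t m
  ∈-labels⇒InLabels {m} m∈ with ∈-++⁻ (interval 1 n) m∈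
  ... | inj₁ m∈ = inj₁ (proj₁ (∈-interval⁻ m∈) , ℕ.≤-pred (proj₂ (∈-interval⁻ m∈)))
  ... | inj₂ m∈top with p , p∈ , refl ← ∈-map⁻ (λ p → A + p) m∈top with ∈-++⁻ (interval 0 X) p∈
  ...   | inj₁ p<X = inj₂ (inj₁ (ℕ.m≤m+n A p , subst (λ b → A + p ≤ b ∸ 1) size (<⇒≤∸1 (ℕ.+-monoʳ-< A (proj₂ (∈-interval⁻ p<X))))))
  ...   | inj₂ (here refl) = inj₂ (inj₂ (≡-trans (sym (ℕ.+-assoc A X t)) (cong (_+ t) size)))

  InLabels⇒∈-labels : ∀ {m} → InLabels n k M t m → m ∈ labels n A X t
  InLabels⇒∈-labels (inj₁ (1≤m , m≤n)) = ∈-++⁺ˡ (∈-interval⁺ 1≤m (s≤s m≤n))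
  InLabels⇒∈-labels {m} (inj₂ (inj₁ (A≤m , m≤M+k-1))) =
    ∈-++⁺ʳ (interval 1 n) (subst (_∈ map (λ p → A + p) (leafPositions X t)) (ℕ.m+[n∸m]≡n A≤m)
      (∈-map⁺ (λ p → A + p) (∈-++⁺ˡ (∈-interval⁺ z≤n (subst (m ∸ A <_) (ℕ.m+n∸m≡n A X) (ℕ.∸-monoˡ-< m<A+X A≤m))))))
    where
    1≤A : 1 ≤ A
    1≤A = ℕ.≤-trans (ℕ.m≤n+m 1 n) (ℕ.m≤m+n (n + 1) k)
    m<A+X : m < A + X
    m<A+X = subst (m <_) (sym size) (≤∸1⇒< (ℕ.≤-trans 1≤A (ℕ.≤-trans A≤m (ℕ.≤-trans m≤M+k-1 (ℕ.m∸n≤m (M + k) 1)))) m≤M+k-1)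
  InLabels⇒∈-labels (inj₂ (inj₂ refl)) =
    ∈-++⁺ʳ (interval 1 n) (subst (_∈ map (λ p → A + p) (leafPositions X t)) (≡-trans (sym (ℕ.+-assoc A X t)) (cong (_+ t) size))
      (∈-map⁺ (λ p → A + p) (∈-++⁺ʳ (interval 0 X) (here refl))))

module Bijection (n₁ n₂ k : ℕ) {M X t : ℕ} (size : n₁ + n₂ + 1 + k + X ≡ M + k) (φ : Edge n₁ n₂ → ℕ)
  (φ-labels : map φ (edges n₁ n₂) ↭ labels (n₁ + n₂) (n₁ + n₂ + 1 + k) X t) where

  open Snowflake n₁ n₂

  labelling-injective : Injective _≡_ _≡_ φ
  labelling-injective = unique-map-injective φ unique (edges-complete _) (edges-complete _)
    where
    unique : Unique (map φ (edges n₁ n₂))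
    unique = Perm.Unique-resp-↭ (≡-setoid ℕ) (↭⇒↭ₛ (↭-sym φ-labels))
               (labels-unique _ _ X t (ℕ.≤-trans (ℕ.≤-reflexive (ℕ.+-comm 1 (n₁ + n₂))) (ℕ.m≤m+n (n₁ + n₂ + 1) k)))

  labelling-InLabels : ∀ e → InLabels (n₁ + n₂) k M t (φ e)
  labelling-InLabels e = ∈-labels⇒InLabels size (∈-resp-↭ φ-labels (∈-map⁺ φ (edges-complete e)))

  labelling-onto : ∀ m → InLabels (n₁ + n₂) k M t m → ∃ λ e → φ e ≡ m
  labelling-onto m m∈ with e , _ , m≡φe ← ∈-map⁻ φ (∈-resp-↭ (↭-sym φ-labels) (InLabels⇒∈-labels size m∈)) = e , sym m≡φe

-- With n ≡ r₄ (mod 4) and n₂ ≡ r₂ (mod 2) we have M = 3n + 2n₂ ≡ 3r₄ + 2r₂ (mod 4).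
residue-determines-t : ∀ {r₄ r₂ t} → r₄ < 4 → r₂ < 2 → t ≡ 0 ⊎ t ≡ 1 →
  (3 * r₄ + 2 * r₂) % 4 ≡ t ⊎ (3 * r₄ + 2 * r₂) % 4 ≡ 3 ∸ t → t ≡ (if 2 ≤ᵇ r₄ then 1 ∸ r₂ else r₂)
residue-determines-t {0} {0} _ _ (inj₁ refl) _  = refl
residue-determines-t {0} {0} _ _ (inj₂ refl) eq = [ (λ ()) , (λ ()) ]′ eq
residue-determines-t {0} {1} _ _ (inj₁ refl) eq = [ (λ ()) , (λ ()) ]′ eq
residue-determines-t {0} {1} _ _ (inj₂ refl) _  = refl
residue-determines-t {1} {0} _ _ (inj₁ refl) _  = refl
residue-determines-t {1} {0} _ _ (inj₂ refl) eq = [ (λ ()) , (λ ()) ]′ eq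
residue-determines-t {1} {1} _ _ (inj₁ refl) eq = [ (λ ()) , (λ ()) ]′ eq
residue-determines-t {1} {1} _ _ (inj₂ refl) _  = refl
residue-determines-t {2} {0} _ _ (inj₁ refl) eq = [ (λ ()) , (λ ()) ]′ eq
residue-determines-t {2} {0} _ _ (inj₂ refl) _  = refl
residue-determines-t {2} {1} _ _ (inj₁ refl) _  = refl
residue-determines-t {2} {1} _ _ (inj₂ refl) eq = [ (λ ()) , (λ ()) ]′ eq
residue-determines-t {3} {0} _ _ (inj₁ refl) eq = [ (λ ()) , (λ ()) ]′ eq
residue-determines-t {3} {0} _ _ (inj₂ refl) _  = refl
residue-determines-t {3} {1} _ _ (inj₁ refl) _  = refl
residue-determines-t {3} {1} _ _ (inj₂ refl) eq = [ (λ ()) , (λ ()) ]′ eq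
residue-determines-t {suc (suc (suc (suc _)))} (s≤s (s≤s (s≤s (s≤s ())))) _ _ _
residue-determines-t {_} {suc (suc _)} _ (s≤s (s≤s ())) _ _

edges-mod-4 : ∀ n₁ n₂ → (3 * n₁ + 5 * n₂) % 4 ≡ (3 * ((n₁ + n₂) % 4) + 2 * (n₂ % 2)) % 4
edges-mod-4 n₁ n₂ = ≡-trans (cong (_% 4) split) ([m+kn]%n≡m%n (3 * r₄ + 2 * r₂) (3 * q₄ + q₂) 4)
  where
  r₄ = (n₁ + n₂) % 4
  q₄ = (n₁ + n₂) / 4
  r₂ = n₂ % 2
  q₂ = n₂ / 2
  regroup : ∀ n₁ n₂ r₄ q₄ r₂ q₂ → n₁ + n₂ ≡ r₄ + q₄ * 4 → n₂ ≡ r₂ + q₂ * 2 →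
    3 * n₁ + 5 * n₂ ≡ 3 * r₄ + 2 * r₂ + (3 * q₄ + q₂) * 4
  regroup n₁ n₂ r₄ q₄ r₂ q₂ n≡ n₂≡ = begin
    3 * n₁ + 5 * n₂             ≡⟨ spread n₁ n₂ ⟩
    3 * (n₁ + n₂) + 2 * n₂      ≡⟨ cong₂ (λ a b → 3 * a + 2 * b) n≡ n₂≡ ⟩
    3 * (r₄ + q₄ * 4) + 2 * (r₂ + q₂ * 2) ≡⟨ gather r₄ q₄ r₂ q₂ ⟩
    3 * r₄ + 2 * r₂ + (3 * q₄ + q₂) * 4 ∎
    where
    open ≡-Reasoning
    spread : ∀ n₁ n₂ → 3 * n₁ + 5 * n₂ ≡ 3 * (n₁ + n₂) + 2 * n₂
    spread = solve-∀
    gather : ∀ r₄ q₄ r₂ q₂ → 3 * (r₄ + q₄ * 4) + 2 * (r₂ + q₂ * 2) ≡ 3 * r₄ + 2 * r₂ + (3 * q₄ + q₂) * 4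
    gather = solve-∀
  split : 3 * n₁ + 5 * n₂ ≡ 3 * r₄ + 2 * r₂ + (3 * q₄ + q₂) * 4
  split = regroup n₁ n₂ r₄ q₄ r₂ q₂ (m≡m%n+[m/n]*n (n₁ + n₂) 4) (m≡m%n+[m/n]*n n₂ 2)

module Arrangement (n₁ n₂ : ℕ) (n≥1 : 1 ≤ n₁ + n₂) where

  n r h w : ℕ
  n = n₁ + n₂
  r = n₂ % 2
  h = n₂ / 2
  w = pred (2 * n)

  n₂≡ : n₂ ≡ r + h * 2
  n₂≡ = m≡m%n+[m/n]*n n₂ 2

  r<2 : r < 2
  r<2 = m%n<n n₂ 2

  2n≡ : 2 * n ≡ suc w
  2n≡ = sym (ℕ.suc-pred (2 * n) {{ℕ.>-nonZero (ℕ.≤-trans n≥1 (ℕ.m≤m+n n (n + 0)))}})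

  pairs : List (ℕ × ℕ)
  pairs = skolem n

  pairStart : ℕ → ℕ
  pairStart = startOf pairs

  diffs₃ : List ℕ
  diffs₃ = interval (suc n₂) n₁

  stars₅ : List K15
  stars₅ = k15Stars (hooked n) w r h

  stars₅-length : length stars₅ ≡ n₂
  stars₅-length = ≡-trans (sym (List.length-map diff stars₅))
                         (≡-trans (cong length (k15Stars-diffs (hooked n) w r h r<2)) (≡-trans (length-interval 1 _) (sym n₂≡)))

  stars : List Star
  stars = map star₃ diffs₃ ++ map star₅ stars₅

  -- The star at the centre v_{c+1}: a K_{1,3} when c < n₁, as in degm1. The default of nth is never used.
  starAt : ℕ → Star
  starAt c = if c <ᵇ n₁ then star₃ (nth 0 diffs₃ c) else star₅ (nth (k15 plus 0 0 0) stars₅ (c ∸ n₁))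

  starAt-enumeration : {B : Set} (F : Star → B) → map (F ∘ starAt ∘ toℕ) (allFin n) ≡ map F stars
  starAt-enumeration F = begin
    map (F ∘ starAt ∘ toℕ) (allFin n)                                          ≡⟨ map-toℕ-allFin (F ∘ starAt) n ⟩
    applyUpTo (F ∘ starAt) (n₁ + n₂)                                            ≡⟨ applyUpTo-if F n₁ n₂ _ _ ⟩
    applyUpTo (F ∘ star₃ ∘ nth 0 diffs₃) n₁ ++ applyUpTo (F ∘ star₅ ∘ nth _ stars₅) n₂
      ≡⟨ cong₂ _++_ (applyUpTo-nth (F ∘ star₃) 0 diffs₃ (length-interval (suc n₂) n₁)) (applyUpTo-nth (F ∘ star₅) _ stars₅ stars₅-length) ⟩
    map (F ∘ star₃) diffs₃ ++ map (F ∘ star₅) stars₅                               ≡⟨ cong₂ _++_ (List.map-∘ diffs₃) (List.map-∘ stars₅) ⟩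
    map F (map star₃ diffs₃) ++ map F (map star₅ stars₅)                           ≡⟨ List.map-++ F (map star₃ diffs₃) _ ⟨
    map F stars                                                                  ∎
    where open ≡-Reasoning

  valueAt : Fin n → ℕ
  valueAt = valueOf ∘ starAt ∘ toℕ

  legsAt : Fin n → List (ℕ × Bool)
  legsAt = legsOf pairStart ∘ starAt ∘ toℕ

  legsAt-length : ∀ i → length (legsAt i) ≡ degm1 n₁ n₂ i
  legsAt-length i = count (toℕ i <ᵇ n₁) _ _
    where
    count : ∀ b d s → length (legsOf pairStart (if b then star₃ d else star₅ s)) ≡ (if b then 2 else 4)
    count true  _ _ = refl
    count false _ _ = refl

  legsAt-balanced : ∀ A i → sumℤ (map (legWeight A) (legsAt i)) ≡ + valueAt i
  legsAt-balanced A i = legsOf-weight A pairStart (starAt (toℕ i)) (valid (toℕ i <ᵇ n₁) _ (toℕ i ∸ n₁))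
    where
    valid : ∀ b d c → ValidStar (if b then star₃ d else star₅ (nth (k15 plus 0 0 0) stars₅ c))
    valid true  _ _ = tt
    valid false _ c = All-nth (k15Stars-valid (hooked n) w r h) tt c

  valueAt-↭ : map valueAt (allFin n) ↭ interval 1 n
  valueAt-↭ = begin
    map valueAt (allFin n)                                   ≡⟨ starAt-enumeration valueOf ⟩
    map valueOf stars                                        ≡⟨ List.map-++ valueOf (map star₃ diffs₃) _ ⟩
    map valueOf (map star₃ diffs₃) ++ map valueOf (map star₅ stars₅)
      ≡⟨ cong₂ _++_ (≡-trans (sym (List.map-∘ diffs₃)) (List.map-id diffs₃)) (sym (List.map-∘ stars₅)) ⟩
    diffs₃ ++ map value stars₅                                 ↭⟨ ++⁺ˡ diffs₃ (subst (λ m → map value stars₅ ↭ interval 1 m) (sym n₂≡)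
                                                                                  (k15Stars-values (hooked n) w r h r<2)) ⟩
    diffs₃ ++ interval 1 n₂                                   ↭⟨ interval-swap n₁ n₂ ⟩
    interval 1 n                                             ∎
    where open PermutationReasoning

  starPair : Star → ℕ × ℕ
  starPair st = differenceOf st , pairStart (differenceOf st)

  stars-differences : map differenceOf stars ↭ differences pairs
  stars-differences = begin
    map differenceOf stars                   ≡⟨ List.map-++ differenceOf (map star₃ diffs₃) _ ⟩
    map differenceOf (map star₃ diffs₃) ++ map differenceOf (map star₅ stars₅)
      ≡⟨ cong₂ _++_ (≡-trans (sym (List.map-∘ diffs₃)) (List.map-id diffs₃))
                    (≡-trans (sym (List.map-∘ stars₅)) (≡-trans (k15Stars-diffs (hooked n) w r h r<2) (cong (interval 1) (sym n₂≡)))) ⟩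
    diffs₃ ++ interval 1 n₂                   ↭⟨ interval-swap n₁ n₂ ⟩
    interval 1 n                             ↭⟨ skolem-differences n ⟨
    differences pairs                        ∎
    where open PermutationReasoning

  stars-pairs : map starPair stars ↭ pairs
  stars-pairs = trans (↭-reflexive (List.map-∘ stars)) (startOf-↭ pairs _ unique stars-differences)
    where
    unique : Unique (differences pairs)
    unique = Perm.Unique-resp-↭ (≡-setoid ℕ) (↭⇒↭ₛ (↭-sym (skolem-differences n))) (interval-unique 1 n)

  stars-extras : concatMap extrasOf stars ≡ concatMap extraEnds stars₅
  stars-extras = ≡-trans (List.concatMap-++ extrasOf (map star₃ diffs₃) _)
                         (≡-trans (cong (_++ concatMap extrasOf (map star₅ stars₅)) (none diffs₃)) (List.concatMap-map extrasOf star₅ stars₅))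
    where
    none : ∀ ds → concatMap extrasOf (map star₃ ds) ≡ []
    none []       = refl
    none (_ ∷ ds) = none ds

  X : ℕ
  X = w + 2 * (r + h * 2)

  legsAt-positions : concatMap (map proj₁ ∘ legsAt) (allFin n) ↭ leafPositions X (if hooked n then 1 ∸ r else r)
  legsAt-positions = begin
    concat (map (map proj₁ ∘ legsAt) (allFin n))                        ≡⟨ cong concat (starAt-enumeration (map proj₁ ∘ legsOf pairStart)) ⟩
    concatMap (map proj₁ ∘ legsOf pairStart) stars                      ≡⟨ List.concatMap-cong (legsOf-positions pairStart) stars ⟩
    concatMap (λ st → pairEnds (starPair st) ++ extrasOf st) stars      ↭⟨ concatMap-++-↭ (pairEnds ∘ starPair) extrasOf stars ⟩
    concatMap (pairEnds ∘ starPair) stars ++ concatMap extrasOf stars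
      ≡⟨ cong₂ _++_ (sym (List.concatMap-map pairEnds starPair stars)) stars-extras ⟩
    endpoints (map starPair stars) ++ concatMap extraEnds stars₅          ↭⟨ ++⁺ʳ _ (concatMap-↭ pairEnds stars-pairs) ⟩
    endpoints pairs ++ concatMap extraEnds stars₅                        ↭⟨ ++⁺ʳ _ (skolem-endpoints n) ⟩
    skolemSupport (hooked n) n ++ concatMap extraEnds stars₅             ↭⟨ ++-comm (skolemSupport (hooked n) n) _ ⟩
    concatMap extraEnds stars₅ ++ skolemSupport (hooked n) n             ↭⟨ k15Stars-positions (hooked n) n w r h 2n≡ r<2 ⟩
    leafPositions X (if hooked n then 1 ∸ r else r)                     ∎
    where open PermutationReasoning

  size : ∀ k → n + 1 + k + X ≡ 3 * n₁ + 5 * n₂ + k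
  size k = begin
    n + 1 + k + (w + 2 * (r + h * 2))    ≡⟨ cong (λ m → n + 1 + k + (w + 2 * m)) (sym n₂≡) ⟩
    n₁ + n₂ + 1 + k + (w + 2 * n₂)        ≡⟨ move n₁ n₂ k w ⟩
    suc w + (n₁ + n₂ + k + 2 * n₂)        ≡⟨ cong (_+ (n₁ + n₂ + k + 2 * n₂)) (sym 2n≡) ⟩
    2 * (n₁ + n₂) + (n₁ + n₂ + k + 2 * n₂) ≡⟨ collect n₁ n₂ k ⟩
    3 * n₁ + 5 * n₂ + k                   ∎
    where
    open ≡-Reasoning
    move : ∀ n₁ n₂ k w → n₁ + n₂ + 1 + k + (w + 2 * n₂) ≡ suc w + (n₁ + n₂ + k + 2 * n₂)
    move = solve-∀
    collect : ∀ n₁ n₂ k → 2 * (n₁ + n₂) + (n₁ + n₂ + k + 2 * n₂) ≡ 3 * n₁ + 5 * n₂ + k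
    collect = solve-∀

lemma33 : (k t n₁ n₂ : ℕ) → (t ≡ 0 ⊎ t ≡ 1) → 1 ≤ n₁ + n₂ →
    ((3 * n₁ + 5 * n₂) % 4 ≡ t ⊎ (3 * n₁ + 5 * n₂) % 4 ≡ 3 ∸ t) →
    Σ (Edge n₁ n₂ → ℕ) λ φ → Σ (Orientation n₁ n₂) λ o →
    (Injective _≡_ _≡_ φ
    × (∀ e → InLabels (n₁ + n₂) k (3 * n₁ + 5 * n₂) t (φ e))
    × (∀ m → InLabels (n₁ + n₂) k (3 * n₁ + 5 * n₂) t m → ∃ λ e → φ e ≡ m))
    × (∀ (i : Fin (n₁ + n₂)) → vsum {n₁} {n₂} o φ (ctr i) ≡ + 0)
    × (vsum {n₁} {n₂} o φ hub ≡ + 1 ⊎ vsum {n₁} {n₂} o φ hub ≡ + 2)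
lemma33 k t n₁ n₂ t∈ n≥1 M%4 =
  φ , o ,
  (labelling-injective , labelling-InLabels , labelling-onto) ,
  vsum-ctr (legsAt-balanced A) ,
  Data.Sum.map (≡-trans (vsum-hub valueAt-↭)) (≡-trans (vsum-hub valueAt-↭)) (proj₂ signs)
  where
  open Arrangement n₁ n₂ n≥1
  A = n + 1 + k
  signs = centreSigns n n≥1
  open Labelling n₁ n₂ A (proj₁ signs) valueAt legsAt legsAt-length
  t≡ : t ≡ (if hooked n then 1 ∸ r else r)
  t≡ = residue-determines-t (m%n<n n 4) r<2 t∈ (Data.Sum.map (≡-trans (sym (edges-mod-4 n₁ n₂))) (≡-trans (sym (edges-mod-4 n₁ n₂))) M%4)
  φ-labels : map φ (edges n₁ n₂) ↭ labels n A X t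
  φ-labels = trans labels-↭ (++⁺ valueAt-↭ (map⁺ (λ p → A + p) (subst (λ t′ → _ ↭ leafPositions X t′) (sym t≡) legsAt-positions)))
  open Bijection n₁ n₂ k (size k) φ φ-labels
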